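{- Let $G$ be a simple graph and $M_3\subset M_4\subset\cdots\subset M_n\subseteq G$ a triangle sequence in $G$. Then: (1) $|V(M_i)|=i$ and $|E(M_i)|=2i-3$ for each $i$; (2) the edges of $S(M_i)$ form a spanning cycle of $M_i$ for each $i$; (3) for each $i$ and every edge $ab\in E(M_i)\setminus S(M_i)$, the vertex pair $\{a,b\}$ separates $M_i$, and if $aa_l,aa_r\in S(M_i)$ are the two edges of $S(M_i)$ at $a$ then $a_l$ and $a_r$ lie in different components of $M_i-\{a,b\}$; (4) if $K_3(a,b,c)$ is any copy of $K_3$ in $M_n$, then there is a triangle sequence $M_3'\subset\cdots\subset M_m'$ in $M_n$ with $M_3'=K_3(a,b,c)$ and $M_m'=M_n$.
   Context: A triangle sequence in a simple graph $G$ is a nested sequence of subgraphs $M_3\subset M_4\subset\cdots\subset M_n\subseteq G$ where $M_3$ is a copy of $K_3$, $|V(M_i)|=|V(M_{i-1})|+1$, and if $V(M_i)\setminus V(M_{i-1})=\{v_i\}$ then $E(M_i)\setminus E(M_{i-1})=\{v_ia_i,v_ib_i\}$ where $a_ib_i\in E(M_{i-1})$ and $a_ib_i$ lies in exactly one copy of $K_3$ in $M_{i-1}$. $S(M_i)$ denotes the set of edges of $M_i$ which lie in exactly one copy of $K_3$ in $M_i$. $K_3(a,b,c)$ denotes a triangle subgraph on vertices $a,b,c$. -}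

module Defs where

open import Level using (0ℓ)
open import Data.Nat using (ℕ; zero; suc; _+_; _*_; _∸_; _≤_)
open import Data.Fin using (Fin; toℕ)
open import Data.List using (List; []; _∷_; _++_; [_]; length; take)
open import Data.List.Membership.Propositional using (_∈_)
open import Data.List.Relation.Unary.Unique.Propositional using (Unique)
open import Data.Product using (Σ; ∃; ∃!; _×_; _,_; proj₁; proj₂)
open import Data.Sum using (_⊎_)
open import Data.Unit using (⊤)
open import Data.Empty using (⊥)
open import Relation.Nullary using (¬_)
open import Relation.Binary.PropositionalEquality using (_≡_; _≢_)
open import Function.Bundles using (_⇔_)

record SimpleGraph (N : ℕ) : Set₁ where
  field
    Adj       : Fin N → Fin N → Set
    Adj-sym   : ∀ {u w} → Adj u w → Adj w u
    Adj-irrefl : ∀ {u} → ¬ Adj u u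
open SimpleGraph public

-- A (sub)graph with vertices among Fin N, given by predicates.
-- Edge u w is to be read as the unordered edge {u,w}.
record Sub (N : ℕ) : Set₁ where
  field
    Vert : Fin N → Set
    Edge : Fin N → Fin N → Set
open Sub public

Pair : ∀ {N} → Fin N → Fin N → Fin N → Fin N → Set
Pair u w p q = (u ≡ p × w ≡ q) ⊎ (u ≡ q × w ≡ p)

SameSub : ∀ {N} → Sub N → Sub N → Set
SameSub M M' = (∀ u → Vert M u ⇔ Vert M' u) × (∀ u w → Edge M u w ⇔ Edge M' u w)

K3 : ∀ {N} → Fin N → Fin N → Fin N → Sub N
Vert (K3 x y z) u = u ≡ x ⊎ u ≡ y ⊎ u ≡ z
Edge (K3 x y z) u w = Pair u w x y ⊎ Pair u w y z ⊎ Pair u w x z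

IsK3 : ∀ {N} → Sub N → Fin N → Fin N → Fin N → Set
IsK3 M a b c = Edge M a b × Edge M b c × Edge M a c

-- the edge ab lies in exactly one copy of K₃ in M
-- (a copy of K₃ containing ab is determined by its third vertex c)
InOneK3 : ∀ {N} → Sub N → Fin N → Fin N → Set
InOneK3 M a b = ∃! _≡_ (λ c → IsK3 M a b c)

SEdge : ∀ {N} → Sub N → Fin N → Fin N → Set
SEdge M a b = Edge M a b × InOneK3 M a b

-- Triangle sequences
-- A triangle sequence is given by M₃ = K₃(x,y,z) and the chronological
-- list of steps (vᵢ , aᵢ , bᵢ), i = 4..n; Mᵢ is then determined.

Step : ℕ → Set
Step N = Fin N × Fin N × Fin N

extend : ∀ {N} → Sub N → Step N → Sub N
Vert (extend M (v , a , b)) u = Vert M u ⊎ u ≡ v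
Edge (extend M (v , a , b)) u w = Edge M u w ⊎ Pair u w v a ⊎ Pair u w v b

build : ∀ {N} → Sub N → List (Step N) → Sub N
build M [] = M
build M (s ∷ ss) = build (extend M s) ss

ValidSteps : ∀ {N} → (Fin N → Fin N → Set) → Sub N → List (Step N) → Set
ValidSteps H M [] = ⊤
ValidSteps H M ((v , a , b) ∷ ss) =
  ¬ Vert M v × Edge M a b × InOneK3 M a b × H v a × H v b
  × ValidSteps H (extend M (v , a , b)) ss

-- (x,y,z), ss is a triangle sequence M₃ ⊂ ... ⊂ Mₙ in host H (n = 3 + length ss)
TriSeq : ∀ {N} → (Fin N → Fin N → Set) → Fin N → Fin N → Fin N → List (Step N) → Set
TriSeq H x y z ss = H x y × H y z × H x z × ValidSteps H (K3 x y z) ss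

-- Mᵢ  (for 3 ≤ i ≤ 3 + length ss)
Mᵢ : ∀ {N} → Fin N → Fin N → Fin N → List (Step N) → ℕ → Sub N
Mᵢ x y z ss i = build (K3 x y z) (take (i ∸ 3) ss)

VCount : ∀ {N} → Sub N → ℕ → Set
VCount M k = Σ (List (Fin _)) λ vs →
  Unique vs × length vs ≡ k × (∀ u → Vert M u ⇔ u ∈ vs)

ECount : ∀ {N} → Sub N → ℕ → Set
ECount {N} M k = Σ (List (Fin N × Fin N)) λ es →
  Unique es × length es ≡ k
  × (∀ u w → (u , w) ∈ es → toℕ u Data.Nat.< toℕ w)
  × (∀ u w → toℕ u Data.Nat.< toℕ w → (Edge M u w ⇔ (u , w) ∈ es))

consec : ∀ {A : Set} → List A → List (A × A)
consec (x ∷ y ∷ r) = (x , y) ∷ consec (y ∷ r)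
consec _ = []

cycEdges : ∀ {A : Set} → List A → List (A × A)
cycEdges [] = []
cycEdges (c ∷ cs) = consec ((c ∷ cs) ++ [ c ])

CycAdj : ∀ {A : Set} → List A → A → A → Set
CycAdj cs u w = (u , w) ∈ cycEdges cs ⊎ (w , u) ∈ cycEdges cs

SSpanningCycle : ∀ {N} → Sub N → Set
SSpanningCycle M = Σ (List (Fin _)) λ cs →
  Unique cs × 3 ≤ length cs × (∀ u → Vert M u ⇔ u ∈ cs)
  × (∀ u w → SEdge M u w ⇔ CycAdj cs u w)

InMinus : ∀ {N} → Sub N → Fin N → Fin N → Fin N → Set
InMinus M a b u = Vert M u × u ≢ a × u ≢ b

-- a walk in M − {a,b} from u to w (u assumed in M − {a,b})
data Walk {N} (M : Sub N) (a b : Fin N) : Fin N → Fin N → Set where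
  nil  : ∀ {u} → Walk M a b u u
  cons : ∀ {u v w} → Edge M u v → InMinus M a b v → Walk M a b v w → Walk M a b u w

DiffComp : ∀ {N} → Sub N → Fin N → Fin N → Fin N → Fin N → Set
DiffComp M a b u w = InMinus M a b u × InMinus M a b w × ¬ Walk M a b u w

Separates : ∀ {N} → Sub N → Fin N → Fin N → Set
Separates M a b = ∃ λ u → ∃ λ w → DiffComp M a b u w

module Submission where

-- Parts (1)–(3) are proved together by induction along the sequence, through
-- an invariant for a graph M with n vertices ('Invariant M n'): M is well
-- formed, S(M) is exactly the edge set of a spanning cycle (a duplicate-free
-- list of its n vertices), M has 2n − 3 edges, every vertex has exactly two
-- S-neighbours, and every non-S edge ab comes with a 'Separation' of M − {a,b}
-- putting the two S-neighbours of a on different sides.  K₃ satisfies the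
-- invariant, and an extension step v ↦ {p,q} preserves it: S changes by
-- subdividing pq with v, which is mirrored by inserting v into the cycle
-- between p and q; pq acquires the separation {v} | rest; and old separations
-- extend by adding v to the side containing p and q.
--
-- Part (4) is proved by induction on the step list from its end: if the last
-- step adds v to pq, a triangle avoiding v is re-rooted in Mₙ₋₁ and the last
-- step is repeated, while the only triangle through v, K₃(v,p,q), is handled by
-- re-rooting Mₙ₋₁ at the unique triangle K₃(p,q,r) on pq and moving the step
-- adding v to the front ('hoist-step').

open import Defs
open import Data.Nat using (ℕ; zero; suc; _≤_; _<_; _+_; _*_; _∸_; _⊓_; z≤n; s≤s; _<?_)
open import Data.Nat.Properties using (≮⇒≥; ≤∧≢⇒<; <-asym; *-suc; +-∸-assoc; ≤-trans; n≤1+n; +-identityʳ; +-suc; +-comm; m≤m+n; m≤n⇒m⊓n≡m; ∸-monoˡ-≤; m+[n∸m]≡n; ≤-refl)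
open import Data.Fin using (Fin; toℕ)
open import Data.Fin.Properties using (_≟_; toℕ-injective)
open import Data.List using (List; []; _∷_; _++_; _∷ʳ_; [_]; length; take)
open import Data.List.Reverse using (Reverse; reverseView; []; _∶_∶ʳ_)
open import Data.List.Properties using (++-assoc; length-++; length-take; take-all)
open import Data.List.Membership.Propositional using (_∈_; _∉_)
open import Data.List.Membership.Propositional.Properties using (∈-++⁺ˡ; ∈-++⁺ʳ; ∈-++⁻)
open import Data.List.Relation.Unary.Any using (here; there)
open import Data.List.Relation.Unary.All as All using ([]; _∷_)
open import Data.List.Relation.Unary.AllPairs as AllPairs using ([]; _∷_)
open import Data.List.Relation.Unary.Unique.Propositional using (Unique)
import Data.List.Relation.Unary.Unique.Propositional.Properties as UniqueP
open UniqueP using (Unique[x∷xs]⇒x∉xs)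
open import Data.List.Relation.Binary.Permutation.Propositional.Properties using (++-comm; ∈-resp-↭; ↭-length)
open import Data.Product using (Σ; _×_; _,_; proj₁; proj₂)
open import Data.Sum using (_⊎_; inj₁; inj₂; [_,_]′; map₁)
open import Data.Unit using (tt)
open import Data.Empty using (⊥; ⊥-elim)
open import Relation.Nullary using (¬_; Dec; yes; no)
open import Relation.Nullary.Decidable using (_×-dec_; _⊎-dec_)
open import Relation.Binary.PropositionalEquality using (_≡_; _≢_; refl; sym; trans; cong; subst; module ≡-Reasoning)
open import Function.Base using (_∘_; id)
open import Function.Bundles using (_⇔_; mk⇔; Equivalence)

open Equivalence using (to; from)

pair-sym : ∀ {N} {u w p q : Fin N} → Pair u w p q → Pair w u p q
pair-sym (inj₁ (a , b)) = inj₂ (b , a)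
pair-sym (inj₂ (a , b)) = inj₁ (b , a)

pair-swap : ∀ {N} {u w p q : Fin N} → Pair u w p q → Pair u w q p
pair-swap (inj₁ (a , b)) = inj₂ (a , b)
pair-swap (inj₂ (a , b)) = inj₁ (a , b)

pair-trans : ∀ {N} {s t u w u' w' : Fin N} → Pair s t u w → Pair s t u' w' → Pair u w u' w'
pair-trans (inj₁ (refl , refl)) (inj₁ (refl , refl)) = inj₁ (refl , refl)
pair-trans (inj₁ (refl , refl)) (inj₂ (refl , refl)) = inj₂ (refl , refl)
pair-trans (inj₂ (refl , refl)) (inj₁ (refl , refl)) = inj₂ (refl , refl)
pair-trans (inj₂ (refl , refl)) (inj₂ (refl , refl)) = inj₁ (refl , refl)

pair? : ∀ {N} (u w p q : Fin N) → Dec (Pair u w p q)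
pair? u w p q = (u ≟ p ×-dec w ≟ q) ⊎-dec (u ≟ q ×-dec w ≟ p)

pair-members : ∀ {N} {a b p q w : Fin N} → Pair a b p q → w ≡ p ⊎ w ≡ q → w ≡ a ⊎ w ≡ b
pair-members (inj₁ (refl , refl)) wpq = wpq
pair-members (inj₂ (refl , refl)) wpq = [ inj₂ , inj₁ ]′ wpq

pair-distinct : ∀ {N} {u w p q : Fin N} → p ≢ q → Pair u w p q → u ≢ w
pair-distinct pq (inj₁ (refl , refl)) = pq
pair-distinct pq (inj₂ (refl , refl)) = pq ∘ sym

pair-other : ∀ {N} {u w w' p q : Fin N} → p ≢ q → Pair u w p q → Pair u w' p q → w ≡ w'
pair-other pq (inj₁ (refl , refl)) (inj₁ (_ , refl)) = refl
pair-other pq (inj₁ (refl , refl)) (inj₂ (up , _)) = ⊥-elim (pq up)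
pair-other pq (inj₂ (refl , refl)) (inj₁ (uq , _)) = ⊥-elim (pq (sym uq))
pair-other pq (inj₂ (refl , refl)) (inj₂ (_ , refl)) = refl

-- The relation R with the edge ab subdivided by the vertex v: ab is removed
-- and va, vb are added.  This describes how both S(M) and the spanning cycle
-- change under an extension step.
Subdivided : ∀ {N} → (Fin N → Fin N → Set) → Fin N → Fin N → Fin N → Fin N → Fin N → Set
Subdivided R v a b u w = (R u w × ¬ Pair u w a b) ⊎ Pair u w v a ⊎ Pair u w v b

subdivided-map : ∀ {N} {R R' : Fin N → Fin N → Set} {v a b u w}
  → (R u w → R' u w) → Subdivided R v a b u w → Subdivided R' v a b u w
subdivided-map f (inj₁ (r , np)) = inj₁ (f r , np)
subdivided-map f (inj₂ new) = inj₂ new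

subdivided-swap : ∀ {N} {R : Fin N → Fin N → Set} {v a b u w}
  → Subdivided R v a b u w → Subdivided R v b a u w
subdivided-swap (inj₁ (r , np)) = inj₁ (r , np ∘ pair-swap)
subdivided-swap (inj₂ (inj₁ x)) = inj₂ (inj₂ x)
subdivided-swap (inj₂ (inj₂ x)) = inj₂ (inj₁ x)

record Wf {N} (M : Sub N) : Set where
  field
    esym : ∀ {u w} → Edge M u w → Edge M w u
    irr : ∀ {u} → ¬ Edge M u u
    ev  : ∀ {u w} → Edge M u w → Vert M u
open Wf public

ev2 : ∀ {N} {M : Sub N} → Wf M → ∀ {u w} → Edge M u w → Vert M w
ev2 W e = ev W (esym W e)

neq : ∀ {N} {M : Sub N} → Wf M → ∀ {u w} → Edge M u w → u ≢ w
neq W e refl = irr W e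

k3swap : ∀ {N} {M : Sub N} → Wf M → ∀ {a b c} → IsK3 M a b c → IsK3 M b a c
k3swap W (e1 , e2 , e3) = esym W e1 , e3 , e2

k3pair : ∀ {N} {M : Sub N} → Wf M → ∀ {s t p q c} → Pair s t p q → IsK3 M s t c → IsK3 M p q c
k3pair W (inj₁ (refl , refl)) k = k
k3pair W (inj₂ (refl , refl)) k = k3swap W k

S-sym : ∀ {N} {M : Sub N} → Wf M → ∀ {s t} → SEdge M s t → SEdge M t s
S-sym W (e , c , k , u) = esym W e , c , k3swap W k , λ k' → u (k3swap W k')

S-pair : ∀ {N} {M : Sub N} → Wf M → ∀ {s t p q} → Pair s t p q → SEdge M p q → SEdge M s t
S-pair W (inj₁ (refl , refl)) spq = spq
S-pair W (inj₂ (refl , refl)) spq = S-sym W spq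

-- One extension step M' = M + v, vp, vq with v a new vertex and pq an edge of
-- M.  The edges of M' are those of M together with vp and vq; the only new
-- triangle is K₃(v,p,q).
module Extension {N} (M : Sub N) (W : Wf M) (v p q : Fin N)
                 (vM : ¬ Vert M v) (epq : Edge M p q) where
  M' : Sub N
  M' = extend M (v , p , q)

  pM : Vert M p
  pM = ev W epq
  qM : Vert M q
  qM = ev2 W epq

  vp : v ≢ p
  vp refl = vM pM
  vq : v ≢ q
  vq refl = vM qM

  notv : ∀ {u} → Vert M u → u ≢ v
  notv h refl = vM h

  W' : Wf M'
  esym W' (inj₁ e) = inj₁ (esym W e)
  esym W' (inj₂ (inj₁ x)) = inj₂ (inj₁ (pair-sym x))
  esym W' (inj₂ (inj₂ x)) = inj₂ (inj₂ (pair-sym x))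
  irr W' (inj₁ e) = irr W e
  irr W' (inj₂ (inj₁ (inj₁ (refl , refl)))) = vp refl
  irr W' (inj₂ (inj₁ (inj₂ (refl , refl)))) = vp refl
  irr W' (inj₂ (inj₂ (inj₁ (refl , refl)))) = vq refl
  irr W' (inj₂ (inj₂ (inj₂ (refl , refl)))) = vq refl
  ev W' (inj₁ e) = inj₁ (ev W e)
  ev W' (inj₂ (inj₁ (inj₁ (refl , _)))) = inj₂ refl
  ev W' (inj₂ (inj₁ (inj₂ (refl , _)))) = inj₁ pM
  ev W' (inj₂ (inj₂ (inj₁ (refl , _)))) = inj₂ refl
  ev W' (inj₂ (inj₂ (inj₂ (refl , _)))) = inj₁ qM

  new-nbr : ∀ {w} → Edge M' v w → w ≡ p ⊎ w ≡ q
  new-nbr (inj₁ e) = ⊥-elim (vM (ev W e))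
  new-nbr (inj₂ (inj₁ (inj₁ (_ , b)))) = inj₁ b
  new-nbr (inj₂ (inj₁ (inj₂ (a , _)))) = ⊥-elim (vp a)
  new-nbr (inj₂ (inj₂ (inj₁ (_ , b)))) = inj₂ b
  new-nbr (inj₂ (inj₂ (inj₂ (a , _)))) = ⊥-elim (vq a)

  old-edge : ∀ {u w} → Edge M' u w → u ≢ v → w ≢ v → Edge M u w
  old-edge (inj₁ e) _ _ = e
  old-edge (inj₂ (inj₁ (inj₁ (a , _)))) n _ = ⊥-elim (n a)
  old-edge (inj₂ (inj₁ (inj₂ (_ , b)))) _ n = ⊥-elim (n b)
  old-edge (inj₂ (inj₂ (inj₁ (a , _)))) n _ = ⊥-elim (n a)
  old-edge (inj₂ (inj₂ (inj₂ (_ , b)))) _ n = ⊥-elim (n b)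

  old-triangle : ∀ {s t c} → Edge M s t → ¬ Pair s t p q → IsK3 M' s t c → IsK3 M s t c
  old-triangle {s} {t} {c} est np (e1 , e2 , e3) with c ≟ v
  ... | no cv = old-edge e1 (notv (ev W est)) (notv (ev2 W est))
              , old-edge e2 (notv (ev2 W est)) cv
              , old-edge e3 (notv (ev W est)) cv
  ... | yes refl with new-nbr (esym W' e2) | new-nbr (esym W' e3)
  ...   | inj₁ a | inj₁ b = ⊥-elim (neq W est (trans b (sym a)))
  ...   | inj₁ a | inj₂ b = ⊥-elim (np (inj₂ (b , a)))
  ...   | inj₂ a | inj₁ b = ⊥-elim (np (inj₁ (b , a)))
  ...   | inj₂ a | inj₂ b = ⊥-elim (neq W est (trans b (sym a)))

  lift-triangle : ∀ {s t c} → IsK3 M s t c → IsK3 M' s t c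
  lift-triangle (e1 , e2 , e3) = inj₁ e1 , inj₁ e2 , inj₁ e3

  unique⁺ : ∀ {s t} → Edge M s t → ¬ Pair s t p q → InOneK3 M s t → InOneK3 M' s t
  unique⁺ est np (c , k , u) = c , lift-triangle k , λ k' → u (old-triangle est np k')

  unique⁻ : ∀ {s t} → Edge M s t → ¬ Pair s t p q → InOneK3 M' s t → InOneK3 M s t
  unique⁻ est np (c , k , u) = c , old-triangle est np k , λ k' → u (lift-triangle k')

  S-keep : ∀ {s t} → SEdge M s t → ¬ Pair s t p q → SEdge M' s t
  S-keep (e , o) np = inj₁ e , unique⁺ e np o

  eVp : Edge M' v p
  eVp = inj₂ (inj₁ (inj₁ (refl , refl)))
  eVq : Edge M' v q
  eVq = inj₂ (inj₂ (inj₁ (refl , refl)))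

  -- the new edges vp and vq lie only in K₃(v,p,q), so they belong to S(M')
  Svp : SEdge M' v p
  Svp = eVp , q , (eVp , inj₁ epq , eVq) , uniq
    where
    uniq : ∀ {d} → IsK3 M' v p d → q ≡ d
    uniq (_ , e2 , e3) with new-nbr e3
    ... | inj₁ refl = ⊥-elim (irr W' e2)
    ... | inj₂ dq = sym dq

  Svq : SEdge M' v q
  Svq = eVq , p , (eVq , inj₁ (esym W epq) , eVp) , uniq
    where
    uniq : ∀ {d} → IsK3 M' v q d → p ≡ d
    uniq (_ , e2 , e3) with new-nbr e3
    ... | inj₁ dp = sym dp
    ... | inj₂ refl = ⊥-elim (irr W' e2)

  -- pq lay in a triangle K₃(p,q,c) of M and now also lies in K₃(p,q,v)
  pq-leaves-S : InOneK3 M p q → ¬ SEdge M' p q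
  pq-leaves-S (c , (_ , e2 , e3) , _) (_ , d , _ , u) =
    notv (ev2 W e2) (trans (sym (u (inj₁ epq , inj₁ e2 , inj₁ e3))) (u (inj₁ epq , esym W' eVq , esym W' eVp)))

  S-ext⇒ : InOneK3 M p q → ∀ {s t} → SEdge M' s t → Subdivided (SEdge M) v p q s t
  S-ext⇒ o {s} {t} (e , oo) with s ≟ v | t ≟ v
  ... | yes refl | _ = [ (λ tp → inj₂ (inj₁ (inj₁ (refl , tp)))) , (λ tq → inj₂ (inj₂ (inj₁ (refl , tq)))) ]′ (new-nbr e)
  ... | no _ | yes refl = [ (λ sp → inj₂ (inj₁ (inj₂ (sp , refl)))) , (λ sq → inj₂ (inj₂ (inj₂ (sq , refl)))) ]′ (new-nbr (esym W' e))
  ... | no sv | no tv with pair? s t p q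
  ...   | yes pr = ⊥-elim (pq-leaves-S o (S-pair W' (pair-trans pr (inj₁ (refl , refl))) (e , oo)))
  ...   | no np = inj₁ ((old-edge e sv tv , unique⁻ (old-edge e sv tv) np oo) , np)

  S-ext⇐ : ∀ {s t} → Subdivided (SEdge M) v p q s t → SEdge M' s t
  S-ext⇐ (inj₁ (x , np)) = S-keep x np
  S-ext⇐ (inj₂ (inj₁ (inj₁ (refl , refl)))) = Svp
  S-ext⇐ (inj₂ (inj₁ (inj₂ (refl , refl)))) = S-sym W' Svp
  S-ext⇐ (inj₂ (inj₂ (inj₁ (refl , refl)))) = Svq
  S-ext⇐ (inj₂ (inj₂ (inj₂ (refl , refl)))) = S-sym W' Svq

  S-ext-at : InOneK3 M p q → ∀ {u w} → u ≢ v → SEdge M' u w → (SEdge M u w × ¬ Pair u w p q) ⊎ w ≡ v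
  S-ext-at o uv s with S-ext⇒ o s
  ... | inj₁ old = inj₁ old
  ... | inj₂ (inj₁ (inj₁ (uv' , _))) = ⊥-elim (uv uv')
  ... | inj₂ (inj₁ (inj₂ (_ , wv))) = inj₂ wv
  ... | inj₂ (inj₂ (inj₁ (uv' , _))) = ⊥-elim (uv uv')
  ... | inj₂ (inj₂ (inj₂ (_ , wv))) = inj₂ wv

module Triangle {N} (x y z : Fin N) (xy : x ≢ y) (yz : y ≢ z) (xz : x ≢ z) where
  K : Sub N
  K = K3 x y z

  InK : Fin N → Set
  InK = Vert K

  e⇒ : ∀ {u w} → Edge K u w → InK u × InK w × u ≢ w
  e⇒ (inj₁ (inj₁ (refl , refl))) = inj₁ refl , inj₂ (inj₁ refl) , xy
  e⇒ (inj₁ (inj₂ (refl , refl))) = inj₂ (inj₁ refl) , inj₁ refl , λ e → xy (sym e)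
  e⇒ (inj₂ (inj₁ (inj₁ (refl , refl)))) = inj₂ (inj₁ refl) , inj₂ (inj₂ refl) , yz
  e⇒ (inj₂ (inj₁ (inj₂ (refl , refl)))) = inj₂ (inj₂ refl) , inj₂ (inj₁ refl) , λ e → yz (sym e)
  e⇒ (inj₂ (inj₂ (inj₁ (refl , refl)))) = inj₁ refl , inj₂ (inj₂ refl) , xz
  e⇒ (inj₂ (inj₂ (inj₂ (refl , refl)))) = inj₂ (inj₂ refl) , inj₁ refl , λ e → xz (sym e)

  e⇐ : ∀ {u w} → InK u → InK w → u ≢ w → Edge K u w
  e⇐ (inj₁ refl) (inj₁ refl) n = ⊥-elim (n refl)
  e⇐ (inj₁ refl) (inj₂ (inj₁ refl)) n = inj₁ (inj₁ (refl , refl))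
  e⇐ (inj₁ refl) (inj₂ (inj₂ refl)) n = inj₂ (inj₂ (inj₁ (refl , refl)))
  e⇐ (inj₂ (inj₁ refl)) (inj₁ refl) n = inj₁ (inj₂ (refl , refl))
  e⇐ (inj₂ (inj₁ refl)) (inj₂ (inj₁ refl)) n = ⊥-elim (n refl)
  e⇐ (inj₂ (inj₁ refl)) (inj₂ (inj₂ refl)) n = inj₂ (inj₁ (inj₁ (refl , refl)))
  e⇐ (inj₂ (inj₂ refl)) (inj₁ refl) n = inj₂ (inj₂ (inj₂ (refl , refl)))
  e⇐ (inj₂ (inj₂ refl)) (inj₂ (inj₁ refl)) n = inj₂ (inj₁ (inj₂ (refl , refl)))
  e⇐ (inj₂ (inj₂ refl)) (inj₂ (inj₂ refl)) n = ⊥-elim (n refl)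

  WK : Wf K
  esym WK e with e⇒ e
  ... | a , b , n = e⇐ b a (λ eq → n (sym eq))
  irr WK e = proj₂ (proj₂ (e⇒ e)) refl
  ev WK e = proj₁ (e⇒ e)

  Third : Fin N → Fin N → Set
  Third u w = Σ (Fin N) λ d → InK d × d ≢ u × d ≢ w × (∀ {d'} → InK d' → d' ≢ u → d' ≢ w → d ≡ d')

  third : ∀ {u w} → InK u → InK w → u ≢ w → Third u w
  third (inj₁ refl) (inj₁ refl) n = ⊥-elim (n refl)
  third (inj₁ refl) (inj₂ (inj₁ refl)) n = z , inj₂ (inj₂ refl) , (λ e → xz (sym e)) , (λ e → yz (sym e)) ,
    λ { (inj₁ refl) a b → ⊥-elim (a refl) ; (inj₂ (inj₁ refl)) a b → ⊥-elim (b refl) ; (inj₂ (inj₂ refl)) a b → refl }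
  third (inj₁ refl) (inj₂ (inj₂ refl)) n = y , inj₂ (inj₁ refl) , (λ e → xy (sym e)) , yz ,
    λ { (inj₁ refl) a b → ⊥-elim (a refl) ; (inj₂ (inj₁ refl)) a b → refl ; (inj₂ (inj₂ refl)) a b → ⊥-elim (b refl) }
  third (inj₂ (inj₁ refl)) (inj₁ refl) n = z , inj₂ (inj₂ refl) , (λ e → yz (sym e)) , (λ e → xz (sym e)) ,
    λ { (inj₁ refl) a b → ⊥-elim (b refl) ; (inj₂ (inj₁ refl)) a b → ⊥-elim (a refl) ; (inj₂ (inj₂ refl)) a b → refl }
  third (inj₂ (inj₁ refl)) (inj₂ (inj₁ refl)) n = ⊥-elim (n refl)
  third (inj₂ (inj₁ refl)) (inj₂ (inj₂ refl)) n = x , inj₁ refl , xy , xz ,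
    λ { (inj₁ refl) a b → refl ; (inj₂ (inj₁ refl)) a b → ⊥-elim (a refl) ; (inj₂ (inj₂ refl)) a b → ⊥-elim (b refl) }
  third (inj₂ (inj₂ refl)) (inj₁ refl) n = y , inj₂ (inj₁ refl) , yz , (λ e → xy (sym e)) ,
    λ { (inj₁ refl) a b → ⊥-elim (b refl) ; (inj₂ (inj₁ refl)) a b → refl ; (inj₂ (inj₂ refl)) a b → ⊥-elim (a refl) }
  third (inj₂ (inj₂ refl)) (inj₂ (inj₁ refl)) n = x , inj₁ refl , xz , xy ,
    λ { (inj₁ refl) a b → refl ; (inj₂ (inj₁ refl)) a b → ⊥-elim (b refl) ; (inj₂ (inj₂ refl)) a b → ⊥-elim (a refl) }
  third (inj₂ (inj₂ refl)) (inj₂ (inj₂ refl)) n = ⊥-elim (n refl)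

  one : ∀ {u w} → Edge K u w → InOneK3 K u w
  one e with e⇒ e
  ... | iu , iw , n with third iu iw n
  ...   | d , id , du , dw , u =
    d , (e , e⇐ iw id (λ eq → dw (sym eq)) , e⇐ iu id (λ eq → du (sym eq))) ,
    λ { (_ , f2 , f3) → u (proj₁ (proj₂ (e⇒ f2))) (proj₂ (proj₂ (e⇒ f3)) ∘ sym) (proj₂ (proj₂ (e⇒ f2)) ∘ sym) }

  allS : ∀ {u w} → Edge K u w → SEdge K u w
  allS e = e , one e

-- To subdivide an edge ab
-- of a cycle by a new vertex v we first rotate the list so that it reads
-- b … a (the edge ab then closes the cycle) and then append v.
module _ {A : Set} where
  consec-++ : ∀ (xs : List A) y ys → consec (xs ++ y ∷ ys) ≡ consec (xs ++ [ y ]) ++ consec (y ∷ ys)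
  consec-++ [] y ys = refl
  consec-++ (x ∷ []) y ys = refl
  consec-++ (x ∷ x' ∷ xs) y ys = cong ((x , x') ∷_) (consec-++ (x' ∷ xs) y ys)

  consec-mem : ∀ {x y : A} l → (x , y) ∈ consec l → x ∈ l × y ∈ l
  consec-mem (a ∷ b ∷ l) (here refl) = here refl , there (here refl)
  consec-mem (a ∷ b ∷ l) (there m) with consec-mem (b ∷ l) m
  ... | p , q = there p , there q

  consec-tl : ∀ {x y : A} b m → (x , y) ∈ consec (b ∷ m) → y ∈ m
  consec-tl b (m0 ∷ m) (here refl) = here refl
  consec-tl b (m0 ∷ m) (there i) = there (consec-tl m0 m i)

  split-consec : ∀ {a b : A} (l : List A) c → (a , b) ∈ consec (l ++ [ c ]) →
    (Σ (List A) λ xs → Σ (List A) λ ys → l ≡ xs ++ a ∷ b ∷ ys) ⊎ (Σ (List A) λ xs → l ≡ xs ++ [ a ] × b ≡ c)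
  split-consec (x ∷ []) c (here refl) = inj₂ ([] , refl , refl)
  split-consec (x ∷ x' ∷ l) c (here refl) = inj₁ ([] , l , refl)
  split-consec (x ∷ x' ∷ l) c (there i) with split-consec (x' ∷ l) c i
  ... | inj₁ (xs , ys , e) = inj₁ (x ∷ xs , ys , cong (x ∷_) e)
  ... | inj₂ (xs , e , f) = inj₂ (x ∷ xs , cong (x ∷_) e , f)

  cycEdges-split : ∀ (p : A) P q Q → cycEdges (p ∷ P ++ q ∷ Q) ≡ consec (p ∷ P ++ [ q ]) ++ consec (q ∷ Q ++ [ p ])
  cycEdges-split p P q Q = trans (cong (λ t → consec (p ∷ t)) (++-assoc P (q ∷ Q) [ p ])) (consec-++ (p ∷ P) q (Q ++ [ p ]))

  cycEdges-rotate : ∀ {e : A × A} p P q Q → e ∈ cycEdges (p ∷ P ++ q ∷ Q) → e ∈ cycEdges (q ∷ Q ++ p ∷ P)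
  cycEdges-rotate {e} p P q Q i =
    subst (e ∈_) (sym (cycEdges-split q Q p P))
      (∈-resp-↭ (++-comm (consec (p ∷ P ++ [ q ])) _) (subst (e ∈_) (cycEdges-split p P q Q) i))

  unique-++⁻ : ∀ (xs : List A) {ys} → Unique (xs ++ ys) → Unique xs × Unique ys × (∀ {u} → u ∈ xs → u ∈ ys → ⊥)
  unique-++⁻ [] u = [] , u , λ ()
  unique-++⁻ (x ∷ xs) (a ∷ u) with unique-++⁻ xs u
  ... | u1 , u2 , d =
    (All.tabulate (λ i → All.lookup a (∈-++⁺ˡ i)) ∷ u1) , u2 ,
    λ { (here refl) j → All.lookup a (∈-++⁺ʳ xs j) refl ; (there i) j → d i j }

  unique-rotate : ∀ (xs : List A) ys → Unique (xs ++ ys) → Unique (ys ++ xs)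
  unique-rotate xs ys u with unique-++⁻ xs u
  ... | u1 , u2 , d = UniqueP.++⁺ u2 u1 (λ (j , i) → d i j)

record SameCycle {A : Set} (cs ds : List A) : Set where
  field
    suniq : Unique cs → Unique ds
    slen : length cs ≡ length ds
    smem⇒ : ∀ {u} → u ∈ cs → u ∈ ds
    smem⇐ : ∀ {u} → u ∈ ds → u ∈ cs
    scyc⇒ : ∀ {e} → e ∈ cycEdges cs → e ∈ cycEdges ds
    scyc⇐ : ∀ {e} → e ∈ cycEdges ds → e ∈ cycEdges cs
open SameCycle public

module _ {A : Set} where
  same-≡ : ∀ {cs ds : List A} → cs ≡ ds → SameCycle cs ds
  same-≡ refl = record { suniq = id ; slen = refl ; smem⇒ = id ; smem⇐ = id ; scyc⇒ = id ; scyc⇐ = id }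

  same-trans : ∀ {cs ds es : List A} → SameCycle cs ds → SameCycle ds es → SameCycle cs es
  same-trans s t = record
    { suniq = λ u → suniq t (suniq s u) ; slen = trans (slen s) (slen t)
    ; smem⇒ = λ i → smem⇒ t (smem⇒ s i) ; smem⇐ = λ i → smem⇐ s (smem⇐ t i)
    ; scyc⇒ = λ i → scyc⇒ t (scyc⇒ s i) ; scyc⇐ = λ i → scyc⇐ s (scyc⇐ t i) }

  same-rotate : ∀ (p : A) P q Q → SameCycle (p ∷ P ++ q ∷ Q) (q ∷ Q ++ p ∷ P)
  same-rotate p P q Q = record
    { suniq = unique-rotate (p ∷ P) (q ∷ Q) ; slen = ↭-length (++-comm (p ∷ P) (q ∷ Q))
    ; smem⇒ = ∈-resp-↭ (++-comm (p ∷ P) (q ∷ Q)) ; smem⇐ = ∈-resp-↭ (++-comm (q ∷ Q) (p ∷ P))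
    ; scyc⇒ = cycEdges-rotate p P q Q ; scyc⇐ = cycEdges-rotate q Q p P }

  snoc-cons : ∀ (xs : List A) a → Σ A λ p → Σ (List A) λ P → xs ++ [ a ] ≡ p ∷ P
  snoc-cons [] a = a , [] , refl
  snoc-cons (x ∷ xs) a = x , xs ++ [ a ] , refl

  rotate-to-edge : ∀ {a b : A} cs → (a , b) ∈ cycEdges cs → 3 ≤ length cs → Σ (List A) λ r → SameCycle cs (b ∷ r ++ [ a ])
  rotate-to-edge (c ∷ cs1) i l3 with split-consec (c ∷ cs1) c i
  rotate-to-edge (c ∷ .[]) i (s≤s ()) | inj₂ ([] , refl , _)
  rotate-to-edge (c ∷ .(r ++ _)) i l3 | inj₂ (.c ∷ r , refl , refl) = r , same-≡ refl
  rotate-to-edge {a} {b} (c ∷ cs1) i l3 | inj₁ (xs , ys , e) with snoc-cons xs a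
  ... | p , P , eq = ys ++ xs , same-trans (same-≡ e1) (same-trans (same-rotate p P b ys) (same-≡ e2))
    where
    e1 : c ∷ cs1 ≡ p ∷ P ++ b ∷ ys
    e1 = trans e (trans (sym (++-assoc xs [ a ] (b ∷ ys))) (cong (_++ b ∷ ys) eq))
    e2 : b ∷ ys ++ p ∷ P ≡ b ∷ (ys ++ xs) ++ [ a ]
    e2 = cong (b ∷_) (trans (cong (ys ++_) (sym eq)) (sym (++-assoc ys xs [ a ])))

  snoc³ : ∀ (r : List A) a v b → ((r ++ [ a ]) ++ [ v ]) ++ [ b ] ≡ r ++ a ∷ v ∷ [ b ]
  snoc³ [] a v b = refl
  snoc³ (x ∷ r) a v b = cong (x ∷_) (snoc³ r a v b)

CycEdge : ∀ {A : Set} → List A → A → A → Set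
CycEdge cs u w = (u , w) ∈ cycEdges cs

module SubdivideCycle {N} (a b v r0 : Fin N) (r' : List (Fin N)) where
  r : List (Fin N)
  r = r0 ∷ r'
  cs0 : List (Fin N)
  cs0 = b ∷ r ++ [ a ]
  cs1 : List (Fin N)
  cs1 = cs0 ++ [ v ]
  E0 : List (Fin N × Fin N)
  E0 = consec cs0

  cyc0 : cycEdges cs0 ≡ E0 ++ (a , b) ∷ []
  cyc0 = trans (cong (λ t → consec (b ∷ t)) (++-assoc r [ a ] [ b ])) (consec-++ (b ∷ r) a [ b ])

  cyc1 : cycEdges cs1 ≡ E0 ++ (a , v) ∷ (v , b) ∷ []
  cyc1 = trans (cong (λ t → consec (b ∷ t)) (snoc³ r a v b)) (consec-++ (b ∷ r) a (v ∷ [ b ]))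

  module _ (uq : Unique cs0) (vn : v ∉ cs0) where
    nab : (a , b) ∉ E0
    nab i = Unique[x∷xs]⇒x∉xs uq (consec-tl b (r ++ [ a ]) i)

    nba : (b , a) ∉ E0
    nba (here refl) = Unique[x∷xs]⇒x∉xs (AllPairs.tail uq) (∈-++⁺ʳ r' (here refl))
    nba (there i) = Unique[x∷xs]⇒x∉xs uq (proj₁ (consec-mem (r0 ∷ r' ++ [ a ]) i))

    notab : ∀ {s t} → (s , t) ∈ E0 → ¬ Pair s t a b
    notab i (inj₁ (refl , refl)) = nab i
    notab i (inj₂ (refl , refl)) = nba i

    to0 : ∀ {s t} → CycEdge cs1 s t → Subdivided (CycEdge cs0) v a b s t
    to0 {s} {t} i with ∈-++⁻ E0 (subst ((s , t) ∈_) cyc1 i)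
    ... | inj₁ j = inj₁ (subst ((s , t) ∈_) (sym cyc0) (∈-++⁺ˡ j) , notab j)
    ... | inj₂ (here refl) = inj₂ (inj₁ (inj₂ (refl , refl)))
    ... | inj₂ (there (here refl)) = inj₂ (inj₂ (inj₁ (refl , refl)))

    from0 : ∀ {s t} → CycEdge cs0 s t → ¬ Pair s t a b → CycEdge cs1 s t
    from0 {s} {t} i np with ∈-++⁻ E0 (subst ((s , t) ∈_) cyc0 i)
    ... | inj₁ j = subst ((s , t) ∈_) (sym cyc1) (∈-++⁺ˡ j)
    ... | inj₂ (here refl) = ⊥-elim (np (inj₁ (refl , refl)))

    eav : CycEdge cs1 a v
    eav = subst ((a , v) ∈_) (sym cyc1) (∈-++⁺ʳ E0 (here refl))
    evb : CycEdge cs1 v b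
    evb = subst ((v , b) ∈_) (sym cyc1) (∈-++⁺ʳ E0 (there (here refl)))

    adj⇒ : ∀ {u w} → CycAdj cs1 u w → Subdivided (CycAdj cs0) v a b u w
    adj⇒ (inj₁ i) with to0 i
    ... | inj₁ (j , np) = inj₁ (inj₁ j , np)
    ... | inj₂ (inj₁ x) = inj₂ (inj₁ x)
    ... | inj₂ (inj₂ x) = inj₂ (inj₂ x)
    adj⇒ (inj₂ i) with to0 i
    ... | inj₁ (j , np) = inj₁ (inj₂ j , λ pr → np (pair-sym pr))
    ... | inj₂ (inj₁ x) = inj₂ (inj₁ (pair-sym x))
    ... | inj₂ (inj₂ x) = inj₂ (inj₂ (pair-sym x))

    adj⇐ : ∀ {u w} → Subdivided (CycAdj cs0) v a b u w → CycAdj cs1 u w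
    adj⇐ (inj₁ (inj₁ i , np)) = inj₁ (from0 i np)
    adj⇐ (inj₁ (inj₂ i , np)) = inj₂ (from0 i (λ pr → np (pair-sym pr)))
    adj⇐ (inj₂ (inj₁ (inj₁ (refl , refl)))) = inj₂ eav
    adj⇐ (inj₂ (inj₁ (inj₂ (refl , refl)))) = inj₁ eav
    adj⇐ (inj₂ (inj₂ (inj₁ (refl , refl)))) = inj₁ evb
    adj⇐ (inj₂ (inj₂ (inj₂ (refl , refl)))) = inj₂ evb

    uq1 : Unique cs1
    uq1 = UniqueP.++⁺ uq ([] ∷ []) λ { (i , here refl) → vn i }

record CycleInsertion {N} (cs : List (Fin N)) (v a b : Fin N) : Set where
  field
    cs' : List (Fin N)
    uq' : Unique cs'
    len' : length cs' ≡ suc (length cs)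
    mem⇒ : ∀ {u} → u ∈ cs' → u ∈ cs ⊎ u ≡ v
    mem⇐ : ∀ {u} → u ∈ cs ⊎ u ≡ v → u ∈ cs'
    cadj⇒ : ∀ {u w} → CycAdj cs' u w → Subdivided (CycAdj cs) v a b u w
    cadj⇐ : ∀ {u w} → Subdivided (CycAdj cs) v a b u w → CycAdj cs' u w
open CycleInsertion public

insert-cycle-oriented : ∀ {N} (cs : List (Fin N)) (v a b : Fin N)
  → Unique cs → 3 ≤ length cs → v ∉ cs → CycEdge cs a b → CycleInsertion cs v a b
insert-cycle-oriented cs v a b uq l3 vn i with rotate-to-edge cs i l3
... | r , S = go r S
  where
  go : ∀ r → SameCycle cs (b ∷ r ++ [ a ]) → CycleInsertion cs v a b
  go [] S = ⊥-elim (bad (subst (3 ≤_) (slen S) l3))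
    where
    bad : ¬ (3 ≤ 2)
    bad (s≤s (s≤s ()))
  go (r0 ∷ r') S = record
    { cs' = cs1 ; uq' = uq1 uq0 vn0
    ; len' = trans (length-++ cs0) (trans (+-comm (length cs0) 1) (cong suc (sym (slen S))))
    ; mem⇒ = λ j → [ (λ k → inj₁ (smem⇐ S k)) , (λ { (here refl) → inj₂ refl }) ]′ (∈-++⁻ cs0 j)
    ; mem⇐ = λ { (inj₁ k) → ∈-++⁺ˡ (smem⇒ S k) ; (inj₂ refl) → ∈-++⁺ʳ cs0 (here refl) }
    ; cadj⇒ = λ c → subdivided-map {R = CycAdj cs0} {R' = CycAdj cs} c⇐ (adj⇒ uq0 vn0 c)
    ; cadj⇐ = λ c → adj⇐ uq0 vn0 (subdivided-map {R = CycAdj cs} {R' = CycAdj cs0} c⇒ c) }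
    where
    open SubdivideCycle a b v r0 r'
    uq0 : Unique cs0
    uq0 = suniq S uq
    vn0 : v ∉ cs0
    vn0 j = vn (smem⇐ S j)
    c⇐ : ∀ {u w} → CycAdj cs0 u w → CycAdj cs u w
    c⇐ (inj₁ j) = inj₁ (scyc⇐ S j)
    c⇐ (inj₂ j) = inj₂ (scyc⇐ S j)
    c⇒ : ∀ {u w} → CycAdj cs u w → CycAdj cs0 u w
    c⇒ (inj₁ j) = inj₁ (scyc⇒ S j)
    c⇒ (inj₂ j) = inj₂ (scyc⇒ S j)

insert-cycle : ∀ {N} (cs : List (Fin N)) (v a b : Fin N)
  → Unique cs → 3 ≤ length cs → v ∉ cs → CycAdj cs a b → CycleInsertion cs v a b
insert-cycle cs v a b uq l3 vn (inj₁ i) = insert-cycle-oriented cs v a b uq l3 vn i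
insert-cycle cs v a b uq l3 vn (inj₂ i) =
  let C = insert-cycle-oriented cs v b a uq l3 vn i in record
  { cs' = cs' C ; uq' = uq' C ; len' = len' C ; mem⇒ = mem⇒ C ; mem⇐ = mem⇐ C
  ; cadj⇒ = subdivided-swap {R = CycAdj cs} ∘ cadj⇒ C ; cadj⇐ = cadj⇐ C ∘ subdivided-swap {R = CycAdj cs} }

ord : ∀ {N} → Fin N → Fin N → Fin N × Fin N
ord u w with toℕ u <? toℕ w
... | yes _ = (u , w)
... | no _ = (w , u)

ord-lt : ∀ {N} (u w : Fin N) → u ≢ w → toℕ (proj₁ (ord u w)) < toℕ (proj₂ (ord u w))
ord-lt u w n with toℕ u <? toℕ w
... | yes l = l
... | no nl = ≤∧≢⇒< (≮⇒≥ nl) (λ e → n (toℕ-injective (sym e)))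

ord-sorted : ∀ {N} {s t u w : Fin N} → (s , t) ≡ ord u w → u ≢ w → toℕ s < toℕ t
ord-sorted {u = u} {w} refl = ord-lt u w

ord-pair : ∀ {N} {s t u w : Fin N} → Pair s t u w → toℕ s < toℕ t → (s , t) ≡ ord u w
ord-pair {u = u} {w} (inj₁ (refl , refl)) lt with toℕ u <? toℕ w
... | yes _ = refl
... | no n = ⊥-elim (n lt)
ord-pair {u = u} {w} (inj₂ (refl , refl)) lt with toℕ u <? toℕ w
... | yes l = ⊥-elim (<-asym l lt)
... | no _ = refl

ord-mem : ∀ {N} {s t : Fin N} (u w : Fin N) → (s , t) ≡ ord u w → Pair s t u w
ord-mem u w e with toℕ u <? toℕ w
ord-mem u w refl | yes _ = inj₁ (refl , refl)
ord-mem u w refl | no _ = inj₂ (refl , refl)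

ord-eq : ∀ {N} (u w u' w' : Fin N) → ord u w ≡ ord u' w' → Pair u w u' w'
ord-eq u w u' w' e = pair-trans (ord-mem u w refl) (ord-mem u' w' e)

-- adding a vertex of degree two to a graph with n ≥ 3 vertices and 2n − 3
-- edges gives 2(n+1) − 3 edges
count-step : ∀ n → 3 ≤ n → 2 * suc n ∸ 3 ≡ suc (suc (2 * n ∸ 3))
count-step n l = trans (cong (_∸ 3) (*-suc 2 n)) (+-∸-assoc 2 (≤-trans l (m≤2m n)))
  where
  m≤2m : ∀ m → m ≤ 2 * m
  m≤2m m = m≤m+n m (m + 0)

SNeighbours : ∀ {N} → Sub N → Fin N → Set
SNeighbours {N} M a = Σ (Fin N) λ l → Σ (Fin N) λ r →
  l ≢ r × SEdge M a l × SEdge M a r × (∀ {w} → SEdge M a w → w ≡ l ⊎ w ≡ r)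

TwoSNeighbours : ∀ {N} → Sub N → Set
TwoSNeighbours M = ∀ a → Vert M a → SNeighbours M a

other-S-nbr : ∀ {N} {M : Sub N} {a b} → SNeighbours M a → SEdge M a b
  → Σ (Fin N) λ r → SEdge M a r × r ≢ b × (∀ {w} → SEdge M a w → w ≡ b ⊎ w ≡ r)
other-S-nbr (l , r , lr , sl , sr , nb) sb with nb sb
... | inj₁ refl = r , sr , (λ x → lr (sym x)) , nb
... | inj₂ refl = l , sl , lr , λ s → [ inj₂ , inj₁ ]′ (nb s)

record Separation {N} (M : Sub N) (a b : Fin N) : Set₁ where
  field
    L R : Fin N → Set
    cover : ∀ {u} → InMinus M a b u → L u ⊎ R u
    Lin : ∀ {u} → L u → InMinus M a b u
    Rin : ∀ {u} → R u → InMinus M a b u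
    disj : ∀ {u} → L u → R u → ⊥
    noLR : ∀ {u w} → Edge M u w → L u → R w → ⊥
    noRL : ∀ {u w} → Edge M u w → R u → L w → ⊥
    l r : Fin N
    Ll : L l
    Rr : R r
    nb : ∀ {w} → SEdge M a w → w ≡ l ⊎ w ≡ r
open Separation using (L; R; cover; Lin; Rin; disj; noLR; noRL; Ll; Rr; nb)

OnLeft : ∀ {N} {M : Sub N} {a b} → Separation M a b → Fin N → Set
OnLeft {a = a} {b} C u = u ≡ a ⊎ u ≡ b ⊎ Separation.L C u

swap-sides : ∀ {N} {M : Sub N} {a b} → Separation M a b → Separation M a b
swap-sides C = record
  { L = R C ; R = L C ; cover = λ i → [ inj₂ , inj₁ ]′ (cover C i) ; Lin = Rin C ; Rin = Lin C
  ; disj = λ x y → disj C y x ; noLR = noRL C ; noRL = noLR C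
  ; l = Separation.r C ; r = Separation.l C ; Ll = Rr C ; Rr = Ll C
  ; nb = λ s → [ inj₂ , inj₁ ]′ (nb C s) }

walk-stays-left : ∀ {N} {M : Sub N} {a b} (C : Separation M a b) → ∀ {u w} → Walk M a b u w → L C u → L C w
walk-stays-left C nil x = x
walk-stays-left C (cons e im w) x with cover C im
... | inj₁ y = walk-stays-left C w y
... | inj₂ y = ⊥-elim (noLR C e x y)

separation-consequences : ∀ {N} {M : Sub N} {a b} → Separation M a b →
  Separates M a b × (∀ al ar → al ≢ ar → SEdge M a al → SEdge M a ar → DiffComp M a b al ar)
separation-consequences {M = M} {a} {b} C = (Separation.l C , Separation.r C , dc (Ll C) (Rr C)) , final
  where
  dc : ∀ {x y} → L C x → R C y → DiffComp M a b x y
  dc Lx Ry = Lin C Lx , Rin C Ry , λ w → disj C (walk-stays-left C w Lx) Ry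
  dc' : ∀ {x y} → R C x → L C y → DiffComp M a b x y
  dc' Rx Ly = Rin C Rx , Lin C Ly , λ w → disj (swap-sides C) (walk-stays-left (swap-sides C) w Rx) Ly
  final : ∀ al ar → al ≢ ar → SEdge M a al → SEdge M a ar → DiffComp M a b al ar
  final al ar n s1 s2 with nb C s1 | nb C s2
  ... | inj₁ refl | inj₁ refl = ⊥-elim (n refl)
  ... | inj₁ refl | inj₂ refl = dc (Ll C) (Rr C)
  ... | inj₂ refl | inj₁ refl = dc' (Rr C) (Ll C)
  ... | inj₂ refl | inj₂ refl = ⊥-elim (n refl)

-- The invariant of a triangle sequence after n − 3 steps (n vertices): the
-- statements (1)–(3) of the theorem, together with the facts needed to
-- propagate them — well-formedness and the two S-neighbours of each vertex.
record Invariant {N} (M : Sub N) (n : ℕ) : Set₁ where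
  field
    wf : Wf M
    n3 : 3 ≤ n
    cs : List (Fin N)
    csU : Unique cs
    csL : length cs ≡ n
    csV : ∀ u → Vert M u ⇔ u ∈ cs
    csS : ∀ u w → SEdge M u w ⇔ CycAdj cs u w
    ec : ECount M (2 * n ∸ 3)
    nbr : TwoSNeighbours M
    seps : ∀ a b → Edge M a b → ¬ SEdge M a b → Separation M a b
open Invariant public

-- The invariant holds for K₃: its spanning cycle is x y z, it has three edges,
-- all of them in S, so there is nothing to separate.
module TriangleInvariant {N} (x y z : Fin N) (xy : x ≢ y) (yz : y ≢ z) (xz : x ≢ z) where
  open Triangle x y z xy yz xz

  csK : List (Fin N)
  csK = x ∷ y ∷ z ∷ []

  S→C : ∀ {u w} → Edge K u w → CycAdj csK u w
  S→C (inj₁ (inj₁ (refl , refl))) = inj₁ (here refl)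
  S→C (inj₁ (inj₂ (refl , refl))) = inj₂ (here refl)
  S→C (inj₂ (inj₁ (inj₁ (refl , refl)))) = inj₁ (there (here refl))
  S→C (inj₂ (inj₁ (inj₂ (refl , refl)))) = inj₂ (there (here refl))
  S→C (inj₂ (inj₂ (inj₁ (refl , refl)))) = inj₂ (there (there (here refl)))
  S→C (inj₂ (inj₂ (inj₂ (refl , refl)))) = inj₁ (there (there (here refl)))

  C→S : ∀ {u w} → CycAdj csK u w → Edge K u w
  C→S (inj₁ (here refl)) = inj₁ (inj₁ (refl , refl))
  C→S (inj₁ (there (here refl))) = inj₂ (inj₁ (inj₁ (refl , refl)))
  C→S (inj₁ (there (there (here refl)))) = inj₂ (inj₂ (inj₂ (refl , refl)))
  C→S (inj₂ (here refl)) = inj₁ (inj₂ (refl , refl))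
  C→S (inj₂ (there (here refl))) = inj₂ (inj₁ (inj₂ (refl , refl)))
  C→S (inj₂ (there (there (here refl)))) = inj₂ (inj₂ (inj₁ (refl , refl)))

  esK : List (Fin N × Fin N)
  esK = ord x y ∷ ord y z ∷ ord x z ∷ []

  d12 : ¬ Pair x y y z
  d12 (inj₁ (a , _)) = xy a
  d12 (inj₂ (a , _)) = xz a
  d13 : ¬ Pair x y x z
  d13 (inj₁ (_ , b)) = yz b
  d13 (inj₂ (a , _)) = xz a
  d23 : ¬ Pair y z x z
  d23 (inj₁ (a , _)) = xy (sym a)
  d23 (inj₂ (a , _)) = yz a

  ecK : ECount K 3
  ecK = esK
      , ((λ e → d12 (ord-eq _ _ _ _ e)) ∷ (λ e → d13 (ord-eq _ _ _ _ e)) ∷ []) ∷ ((λ e → d23 (ord-eq _ _ _ _ e)) ∷ []) ∷ [] ∷ []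
      , refl
      , (λ { u w (here e) → ord-sorted e xy
           ; u w (there (here e)) → ord-sorted e yz
           ; u w (there (there (here e))) → ord-sorted e xz })
      , λ u w lt → mk⇔
          (λ { (inj₁ pr) → here (ord-pair pr lt) ; (inj₂ (inj₁ pr)) → there (here (ord-pair pr lt))
             ; (inj₂ (inj₂ pr)) → there (there (here (ord-pair pr lt))) })
          (λ { (here e) → inj₁ (ord-mem x y e) ; (there (here e)) → inj₂ (inj₁ (ord-mem y z e))
             ; (there (there (here e))) → inj₂ (inj₂ (ord-mem x z e)) })

  nbrs-of : ∀ {a l r} → InK a → InK l → InK r → a ≢ l → a ≢ r → l ≢ r → SNeighbours K a
  nbrs-of {a} {l} {r} ia il ir al ar lr =
    l , r , lr , allS (e⇐ ia il al) , allS (e⇐ ia ir ar) , λ s → other (e⇒ (proj₁ s))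
    where
    other : ∀ {w} → InK a × InK w × a ≢ w → w ≡ l ⊎ w ≡ r
    other {w} (_ , iw , aw) with w ≟ l
    ... | yes wl = inj₁ wl
    ... | no wl = let (_ , _ , _ , _ , unique) = third ia il al in
                  inj₂ (trans (sym (unique iw (aw ∘ sym) wl)) (unique ir (ar ∘ sym) (lr ∘ sym)))

  nbrK : TwoSNeighbours K
  nbrK a (inj₁ refl) = nbrs-of (inj₁ refl) (inj₂ (inj₁ refl)) (inj₂ (inj₂ refl)) xy xz yz
  nbrK a (inj₂ (inj₁ refl)) = nbrs-of (inj₂ (inj₁ refl)) (inj₁ refl) (inj₂ (inj₂ refl)) (xy ∘ sym) yz xz
  nbrK a (inj₂ (inj₂ refl)) = nbrs-of (inj₂ (inj₂ refl)) (inj₁ refl) (inj₂ (inj₁ refl)) (xz ∘ sym) (yz ∘ sym) xy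

  invariant-base : Invariant K 3
  invariant-base = record
    { wf = WK ; n3 = s≤s (s≤s (s≤s z≤n)) ; cs = csK
    ; csU = ((xy ∷ xz ∷ []) ∷ (yz ∷ []) ∷ [] ∷ [])
    ; csL = refl
    ; csV = λ u → mk⇔ (λ { (inj₁ e) → here e ; (inj₂ (inj₁ e)) → there (here e) ; (inj₂ (inj₂ e)) → there (there (here e)) })
                      (λ { (here e) → inj₁ e ; (there (here e)) → inj₂ (inj₁ e) ; (there (there (here e))) → inj₂ (inj₂ e) })
    ; csS = λ u w → mk⇔ (λ s → S→C (proj₁ s)) (λ c → allS (C→S c))
    ; ec = ecK ; nbr = nbrK
    ; seps = λ a b e nS → ⊥-elim (nS (allS e)) }

module InvariantStep {N} (M : Sub N) (n : ℕ) (I : Invariant M n) (v p q : Fin N)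
                     (vM : ¬ Vert M v) (epq : Edge M p q) (o : InOneK3 M p q) where
  W : Wf M
  W = wf I
  open Extension M W v p q vM epq

  Spq : SEdge M p q
  Spq = epq , o

  pq : p ≢ q
  pq = neq W epq

  C : CycleInsertion (cs I) v p q
  C = insert-cycle (cs I) v p q (csU I) (subst (3 ≤_) (sym (csL I)) (n3 I))
        (λ i → vM (from (csV I v) i)) (to (csS I p q) Spq)

  ec' : ECount M' (2 * suc n ∸ 3)
  ec' with ec I
  ... | es , U , len , sorted , iff = es' , U' , lenE , sorted' , iff'
    where
    es' : List (Fin N × Fin N)
    es' = ord v p ∷ ord v q ∷ es
    inV : ∀ {s t} → (s , t) ∈ es → Vert M s × Vert M t
    inV {s} {t} i = let e = from (iff s t (sorted s t i)) i in ev W e , ev2 W e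
    vnot : ∀ {w} → (Σ (Fin N) λ a → Pair (proj₁ w) (proj₂ w) v a) → w ∉ es
    vnot (_ , inj₁ (refl , _)) i = vM (proj₁ (inV i))
    vnot (_ , inj₂ (_ , refl)) i = vM (proj₂ (inV i))
    U' : Unique es'
    U' = ((λ e → [ (λ { (_ , pq') → pq pq' }) , (λ { (a , _) → vq a }) ]′ (ord-eq v p v q e))
          ∷ All.tabulate (λ i e → vnot (p , ord-mem v p refl) (subst (_∈ es) (sym e) i)))
       ∷ All.tabulate (λ i e → vnot (q , ord-mem v q refl) (subst (_∈ es) (sym e) i))
       ∷ U
    lenE : length es' ≡ 2 * suc n ∸ 3
    lenE = trans (cong (λ k → suc (suc k)) len) (sym (count-step n (n3 I)))
    sorted' : ∀ u w → (u , w) ∈ es' → toℕ u < toℕ w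
    sorted' u w (here e) = ord-sorted e vp
    sorted' u w (there (here e)) = ord-sorted e vq
    sorted' u w (there (there i)) = sorted u w i
    iff' : ∀ u w → toℕ u < toℕ w → (Edge M' u w ⇔ (u , w) ∈ es')
    iff' u w lt = mk⇔
      (λ { (inj₁ e) → there (there (to (iff u w lt) e)) ; (inj₂ (inj₁ pr)) → here (ord-pair pr lt)
         ; (inj₂ (inj₂ pr)) → there (here (ord-pair pr lt)) })
      (λ { (here e) → inj₂ (inj₁ (ord-mem v p e)) ; (there (here e)) → inj₂ (inj₂ (ord-mem v q e))
         ; (there (there i)) → inj₁ (from (iff u w lt) i) })

  -- p and q keep one old S-neighbour each and exchange the other one (q,
  -- resp. p) for v; here u is p or q and u' is the other one
  module ReplaceNbr (u u' : Fin N) (uM : Vert M u) (uu' : Pair u u' p q) where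
    S-uv : SEdge M' u v
    S-uv = [ (λ (up , _) → subst (λ t → SEdge M' t v) (sym up) (S-sym W' Svp))
           , (λ (uq , _) → subst (λ t → SEdge M' t v) (sym uq) (S-sym W' Svq)) ]′ uu'

    keep : ∀ {w} → SEdge M u w → w ≢ u' → SEdge M' u w
    keep s wu' = S-keep s (λ pr → wu' (pair-other pq pr uu'))

    changed : ∀ {w} → SEdge M' u w → w ≡ v ⊎ (SEdge M u w × w ≢ u')
    changed s with S-ext-at o (notv uM) s
    ... | inj₁ (s' , np) = inj₂ (s' , λ e → np (subst (λ t → Pair u t p q) (sym e) uu'))
    ... | inj₂ wv = inj₁ wv

    replace-nbr : SNeighbours M u → SNeighbours M' u
    replace-nbr (l , r , lr , sl , sr , nb) with nb (S-pair W uu' Spq)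
    ... | inj₁ refl = v , r , (λ e → notv (ev2 W (proj₁ sr)) (sym e)) , S-uv , keep sr (λ e → lr (sym e)) ,
      λ s → [ inj₁ , (λ (s' , wu') → [ (λ e → ⊥-elim (wu' e)) , inj₂ ]′ (nb s')) ]′ (changed s)
    ... | inj₂ refl = l , v , (λ e → notv (ev2 W (proj₁ sl)) e) , keep sl lr , S-uv ,
      λ s → [ inj₂ , (λ (s' , wu') → [ inj₁ , (λ e → ⊥-elim (wu' e)) ]′ (nb s')) ]′ (changed s)

  keep-nbr : ∀ u → Vert M u → u ≢ p → u ≢ q → SNeighbours M u → SNeighbours M' u
  keep-nbr u uM up uq (l , r , lr , sl , sr , nb) = l , r , lr , S-keep sl np , S-keep sr np , λ s → nb (old s)
    where
    np : ∀ {w} → ¬ Pair u w p q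
    np (inj₁ (e , _)) = up e
    np (inj₂ (e , _)) = uq e
    old : ∀ {w} → SEdge M' u w → SEdge M u w
    old s with S-ext-at o (notv uM) s
    ... | inj₁ (s' , _) = s'
    ... | inj₂ refl = ⊥-elim ([ up , uq ]′ (new-nbr (esym W' (proj₁ s))))

  nbr' : TwoSNeighbours M'
  nbr' u (inj₂ refl) = p , q , pq , Svp , Svq , λ s → new-nbr (proj₁ s)
  nbr' u (inj₁ uM) with u ≟ p | u ≟ q
  ... | yes refl | _ = ReplaceNbr.replace-nbr p q uM (inj₁ (refl , refl)) (nbr I p uM)
  ... | no _ | yes refl = ReplaceNbr.replace-nbr q p uM (inj₂ (refl , refl)) (nbr I q uM)
  ... | no up | no uq = keep-nbr u uM up uq (nbr I u uM)

  S-at-v : ∀ {w} → Edge M' v w → SEdge M' v w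
  S-at-v e with new-nbr e
  ... | inj₁ refl = Svp
  ... | inj₂ refl = Svq

  -- Separations for a non-S edge ab of M'.  Such an edge is an old edge: either
  -- pq itself, or an old non-S edge whose separation in M is extended by
  -- putting v on the side containing p and q.
  module SeparationStep (a b : Fin N) (e : Edge M' a b) (nS : ¬ SEdge M' a b) where
    av : a ≢ v
    av refl = nS (S-at-v e)
    bv : b ≢ v
    bv refl = nS (S-sym W' (S-at-v (esym W' e)))
    eab : Edge M a b
    eab = old-edge e av bv
    aM : Vert M a
    aM = ev W eab
    va : v ≢ a
    va x = av (sym x)
    vb : v ≢ b
    vb x = bv (sym x)

    lift : ∀ {u} → InMinus M a b u → InMinus M' a b u
    lift (x , y , z) = inj₁ x , y , z

    S-nbr-a : ∀ {w} → SEdge M' a w → (SEdge M a w × ¬ Pair a w p q) ⊎ w ≡ v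
    S-nbr-a = S-ext-at o av

    -- if ab is the edge pq, v forms one side and everything else the other
    new-separation : Pair a b p q → Separation M' a b
    new-separation pr with other-S-nbr {M = M} (nbr I a aM) (S-pair W pr Spq)
    ... | r , sr , rb , only = record
      { L = _≡ v ; R = InMinus M a b
      ; cover = λ { (inj₁ uM , x , y) → inj₂ (uM , x , y) ; (inj₂ refl , _ , _) → inj₁ refl }
      ; Lin = λ { refl → inj₂ refl , va , vb }
      ; Rin = lift
      ; disj = λ { refl (uM , _) → vM uM }
      ; noLR = λ { e' refl (_ , x , y) → [ x , y ]′ (pair-members pr (new-nbr e')) }
      ; noRL = λ { e' (_ , x , y) refl → [ x , y ]′ (pair-members pr (new-nbr (esym W' e'))) }
      ; l = v ; r = r ; Ll = refl
      ; Rr = ev2 W (proj₁ sr) , (λ x → neq W (proj₁ sr) (sym x)) , rb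
      ; nb = λ s → [ inj₁ , (λ (s' , wb) → [ (λ e → ⊥-elim (wb e)) , inj₂ ]′ (only s')) ]′ (ReplaceNbr.changed a b aM pr s) }

    -- Extending a separation L | R of M − {a,b} for ab ≠ pq, assuming p and q
    -- lie in L ∪ {a,b}: v joins L, and a's S-neighbour in L may change to v.
    module ExtendOld (np : ¬ Pair a b p q) (C : Separation M a b)
              (hp : OnLeft C p) (hq : OnLeft C q) where
      open Separation C using () renaming (L to L0; R to R0)
      -- v has no neighbour in R
      notR : ∀ {w} → OnLeft C w → R0 w → ⊥
      notR (inj₁ x) Rw = proj₁ (proj₂ (Separation.Rin C Rw)) x
      notR (inj₂ (inj₁ x)) Rw = proj₂ (proj₂ (Separation.Rin C Rw)) x
      notR (inj₂ (inj₂ x)) Rw = Separation.disj C x Rw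
      badV : ∀ {w} → w ≡ p ⊎ w ≡ q → R0 w → ⊥
      badV (inj₁ refl) = notR hp
      badV (inj₂ refl) = notR hq
      vnR : ∀ {w} → R0 w → w ≢ v
      vnR Rw = notv (proj₁ (Separation.Rin C Rw))
      vnL : ∀ {w} → L0 w → w ≢ v
      vnL Lw = notv (proj₁ (Separation.Lin C Lw))

      NbrsA : Set
      NbrsA = Σ (Fin N) λ l' → (L0 l' ⊎ l' ≡ v) × (∀ {w} → SEdge M' a w → w ≡ l' ⊎ w ≡ Separation.r C)

      -- if a ∈ {p,q}, its S-neighbour u' ∈ {p,q} lies on the L-side and is
      -- replaced by v
      via-pq : ∀ u' → Pair a u' p q → OnLeft C u' → NbrsA
      via-pq u' au' hu' with Separation.nb C (S-pair W au' Spq)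
      ... | inj₂ refl = ⊥-elim (Separation.disj C Lu' (Separation.Rr C))
        where
        Lu' : L0 u'
        Lu' = [ (λ e → ⊥-elim (pair-distinct pq au' (sym e))) , [ (λ e → ⊥-elim (np (subst (λ t → Pair a t p q) e au'))) , id ]′ ]′ hu'
      ... | inj₁ refl = v , inj₂ refl ,
        λ s → [ inj₁ , (λ (s' , wu') → [ (λ e → ⊥-elim (wu' e)) , inj₂ ]′ (Separation.nb C s')) ]′ (ReplaceNbr.changed a u' aM au' s)

      nbrs-a : NbrsA
      nbrs-a with a ≟ p | a ≟ q
      ... | yes ap | _ = via-pq q (inj₁ (ap , refl)) hq
      ... | no _ | yes aq = via-pq p (inj₂ (aq , refl)) hp
      ... | no a≢p | no a≢q = Separation.l C , inj₁ (Separation.Ll C) ,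
        λ s → [ (λ (s' , _) → Separation.nb C s') , (λ { refl → ⊥-elim ([ a≢p , a≢q ]′ (new-nbr (esym W' (proj₁ s)))) }) ]′ (S-nbr-a s)

      ext : Separation M' a b
      ext = record
        { L = λ u → L0 u ⊎ u ≡ v ; R = R0
        ; cover = λ { (inj₁ uM , x , y) → map₁ inj₁ (Separation.cover C (uM , x , y))
                    ; (inj₂ refl , _ , _) → inj₁ (inj₂ refl) }
        ; Lin = λ { (inj₁ Lu) → lift (Separation.Lin C Lu) ; (inj₂ refl) → inj₂ refl , va , vb }
        ; Rin = λ Ru → lift (Separation.Rin C Ru)
        ; disj = λ { (inj₁ Lu) Ru → Separation.disj C Lu Ru ; (inj₂ refl) Rv → vnR Rv refl }
        ; noLR = λ { e' (inj₁ Lu) Rw → Separation.noLR C (old-edge e' (vnL Lu) (vnR Rw)) Lu Rw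
                   ; e' (inj₂ refl) Rw → badV (new-nbr e') Rw }
        ; noRL = λ { e' Ru (inj₁ Lw) → Separation.noRL C (old-edge e' (vnR Ru) (vnL Lw)) Ru Lw
                   ; e' Ru (inj₂ refl) → badV (new-nbr (esym W' e')) Ru }
        ; l = proj₁ nbrs-a ; r = Separation.r C ; Ll = [ inj₁ , inj₂ ]′ (proj₁ (proj₂ nbrs-a)) ; Rr = Separation.Rr C
        ; nb = proj₂ (proj₂ nbrs-a) }

    locate : (C : Separation M a b) → ∀ {u} → Vert M u → (u ≡ a ⊎ u ≡ b) ⊎ (Separation.L C u ⊎ Separation.R C u)
    locate C {u} uM with u ≟ a | u ≟ b
    ... | yes x | _ = inj₁ (inj₁ x)
    ... | no _ | yes y = inj₁ (inj₂ y)
    ... | no x | no y = inj₂ (Separation.cover C (uM , x , y))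

    -- pq does not cross the separation, so after possibly swapping the sides
    -- both p and q are OnLeft
    old-separation : ¬ Pair a b p q → Separation M a b → Separation M' a b
    old-separation np C0 with locate C0 pM | locate C0 qM
    ... | inj₂ (inj₁ Lp) | inj₁ (inj₁ x) = ExtendOld.ext np C0 (inj₂ (inj₂ Lp)) (inj₁ x)
    ... | inj₂ (inj₁ Lp) | inj₁ (inj₂ x) = ExtendOld.ext np C0 (inj₂ (inj₂ Lp)) (inj₂ (inj₁ x))
    ... | inj₂ (inj₁ Lp) | inj₂ (inj₁ Lq) = ExtendOld.ext np C0 (inj₂ (inj₂ Lp)) (inj₂ (inj₂ Lq))
    ... | inj₂ (inj₁ Lp) | inj₂ (inj₂ Rq) = ⊥-elim (Separation.noLR C0 epq Lp Rq)
    ... | inj₂ (inj₂ Rp) | inj₁ (inj₁ x) = ExtendOld.ext np (swap-sides C0) (inj₂ (inj₂ Rp)) (inj₁ x)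
    ... | inj₂ (inj₂ Rp) | inj₁ (inj₂ x) = ExtendOld.ext np (swap-sides C0) (inj₂ (inj₂ Rp)) (inj₂ (inj₁ x))
    ... | inj₂ (inj₂ Rp) | inj₂ (inj₁ Lq) = ⊥-elim (Separation.noRL C0 epq Rp Lq)
    ... | inj₂ (inj₂ Rp) | inj₂ (inj₂ Rq) = ExtendOld.ext np (swap-sides C0) (inj₂ (inj₂ Rp)) (inj₂ (inj₂ Rq))
    ... | inj₁ x | inj₂ (inj₁ Lq) = ExtendOld.ext np C0 ([ inj₁ , (λ y → inj₂ (inj₁ y)) ]′ x) (inj₂ (inj₂ Lq))
    ... | inj₁ x | inj₂ (inj₂ Rq) = ExtendOld.ext np (swap-sides C0) ([ inj₁ , (λ y → inj₂ (inj₁ y)) ]′ x) (inj₂ (inj₂ Rq))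
    ... | inj₁ (inj₁ x) | inj₁ (inj₁ y) = ⊥-elim (pq (trans x (sym y)))
    ... | inj₁ (inj₁ x) | inj₁ (inj₂ y) = ⊥-elim (np (inj₁ (sym x , sym y)))
    ... | inj₁ (inj₂ x) | inj₁ (inj₁ y) = ⊥-elim (np (inj₂ (sym y , sym x)))
    ... | inj₁ (inj₂ x) | inj₁ (inj₂ y) = ⊥-elim (pq (trans x (sym y)))

    separation : Separation M' a b
    separation with pair? a b p q
    ... | yes pr = new-separation pr
    ... | no np = old-separation np (seps I a b eab (λ s → nS (S-keep s np)))


  invariant' : Invariant M' (suc n)
  invariant' = record
    { wf = W' ; n3 = ≤-trans (n3 I) (n≤1+n n) ; cs = cs' C ; csU = uq' C
    ; csL = trans (len' C) (cong suc (csL I))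
    ; csV = λ u → mk⇔ (λ { (inj₁ uM) → mem⇐ C (inj₁ (to (csV I u) uM)) ; (inj₂ e) → mem⇐ C (inj₂ e) })
                      (λ i → [ (λ j → inj₁ (from (csV I u) j)) , inj₂ ]′ (mem⇒ C i))
    ; csS = λ u w → mk⇔ (cadj⇐ C ∘ subdivided-map {R = SEdge M} {R' = CycAdj (cs I)} (to (csS I u w)) ∘ S-ext⇒ o)
                          (S-ext⇐ ∘ subdivided-map {R = CycAdj (cs I)} {R' = SEdge M} (from (csS I u w)) ∘ cadj⇒ C)
    ; ec = ec' ; nbr = nbr' ; seps = SeparationStep.separation }

invariant-build : ∀ {N} (H : Fin N → Fin N → Set) (M : Sub N) n ss
  → Invariant M n → ValidSteps H M ss → Invariant (build M ss) (n + length ss)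
invariant-build H M n [] I _ = subst (Invariant M) (sym (+-identityʳ n)) I
invariant-build H M n ((v , p , q) ∷ ss) I (vM , epq , o , _ , _ , vs) =
  subst (Invariant (build (extend M (v , p , q)) ss)) (sym (+-suc n (length ss)))
    (invariant-build H (extend M (v , p , q)) (suc n) ss (InvariantStep.invariant' M n I v p q vM epq o) vs)

module _ {N : ℕ} where
  ss-sym : ∀ {M M' : Sub N} → SameSub M M' → SameSub M' M
  ss-sym (V , E) = (λ u → mk⇔ (from (V u)) (to (V u))) , (λ u w → mk⇔ (from (E u w)) (to (E u w)))

  ss-trans : ∀ {M M' M'' : Sub N} → SameSub M M' → SameSub M' M'' → SameSub M M''
  ss-trans (V , E) (V' , E') = (λ u → mk⇔ (to (V' u) ∘ to (V u)) (from (V u) ∘ from (V' u)))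
                             , (λ u w → mk⇔ (to (E' u w) ∘ to (E u w)) (from (E u w) ∘ from (E' u w)))

  ss-ext : ∀ {M M' : Sub N} s → SameSub M M' → SameSub (extend M s) (extend M' s)
  ss-ext s (V , E) = (λ u → mk⇔ (map₁ (to (V u))) (map₁ (from (V u))))
                   , (λ u w → mk⇔ (map₁ (to (E u w))) (map₁ (from (E u w))))

  ss-build : ∀ {M M' : Sub N} ss → SameSub M M' → SameSub (build M ss) (build M' ss)
  ss-build [] S = S
  ss-build (s ∷ ss) S = ss-build ss (ss-ext s S)

  ss-k3 : ∀ {M M' : Sub N} → SameSub M M' → ∀ {a b c} → IsK3 M a b c → IsK3 M' a b c
  ss-k3 (V , E) (e1 , e2 , e3) = to (E _ _) e1 , to (E _ _) e2 , to (E _ _) e3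

  ss-one : ∀ {M M' : Sub N} → SameSub M M' → ∀ {a b} → InOneK3 M a b → InOneK3 M' a b
  ss-one S (c , k , u) = c , ss-k3 S k , λ k' → u (ss-k3 (ss-sym S) k')

  ss-valid : ∀ {H} {M M' : Sub N} ss → SameSub M M' → ValidSteps H M ss → ValidSteps H M' ss
  ss-valid [] S _ = tt
  ss-valid ((v , a , b) ∷ ss) S (vM , e , o , h1 , h2 , vs) =
    (λ x → vM (from (proj₁ S v) x)) , to (proj₂ S a b) e , ss-one S o , h1 , h2 , ss-valid ss (ss-ext _ S) vs

  ext-comm : ∀ (M : Sub N) s t → SameSub (extend (extend M s) t) (extend (extend M t) s)
  ext-comm M s t = (λ u → mk⇔ swap₃ swap₃) , (λ u w → mk⇔ swap₃ swap₃)
    where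
    swap₃ : ∀ {A B C : Set} → (A ⊎ B) ⊎ C → (A ⊎ C) ⊎ B
    swap₃ (inj₁ (inj₁ x)) = inj₁ (inj₁ x)
    swap₃ (inj₁ (inj₂ x)) = inj₂ x
    swap₃ (inj₂ x) = inj₁ (inj₂ x)

module _ {N : ℕ} where
  valid-mono : ∀ {H H' : Fin N → Fin N → Set} {M : Sub N} ss → (∀ {u w} → H u w → H' u w) → ValidSteps H M ss → ValidSteps H' M ss
  valid-mono [] f _ = tt
  valid-mono (s ∷ ss) f (vM , e , o , h1 , h2 , vs) = vM , e , o , f h1 , f h2 , valid-mono ss f vs

  build-snoc : ∀ (M : Sub N) ss s → build M (ss ∷ʳ s) ≡ extend (build M ss) s
  build-snoc M [] s = refl
  build-snoc M (t ∷ ss) s = build-snoc (extend M t) ss s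

  ValidStep : (Fin N → Fin N → Set) → Sub N → Step N → Set
  ValidStep H M (v , a , b) = ¬ Vert M v × Edge M a b × InOneK3 M a b × H v a × H v b

  valid-snoc⇒ : ∀ {H} (M : Sub N) ss s → ValidSteps H M (ss ∷ʳ s) → ValidSteps H M ss × ValidStep H (build M ss) s
  valid-snoc⇒ M [] s (a , b , c , d , e , _) = tt , (a , b , c , d , e)
  valid-snoc⇒ M (t ∷ ss) s (a , b , c , d , e , r) =
    let (V , st) = valid-snoc⇒ (extend M t) ss s r in (a , b , c , d , e , V) , st

  valid-snoc⇐ : ∀ {H} (M : Sub N) ss s → ValidSteps H M ss → ValidStep H (build M ss) s → ValidSteps H M (ss ∷ʳ s)
  valid-snoc⇐ M [] s _ (a , b , c , d , e) = a , b , c , d , e , tt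
  valid-snoc⇐ M (t ∷ ss) s (a , b , c , d , e , r) y = a , b , c , d , e , valid-snoc⇐ (extend M t) ss s r y

  build-edge : ∀ (M : Sub N) ss {u w} → Edge M u w → Edge (build M ss) u w
  build-edge M [] e = e
  build-edge M (s ∷ ss) e = build-edge (extend M s) ss (inj₁ e)

  build-vert : ∀ (M : Sub N) ss {u} → Vert M u → Vert (build M ss) u
  build-vert M [] e = e
  build-vert M (s ∷ ss) e = build-vert (extend M s) ss (inj₁ e)

  build-wf : ∀ {H} (M : Sub N) ss → Wf M → ValidSteps H M ss → Wf (build M ss)
  build-wf M [] W _ = W
  build-wf M ((v , a , b) ∷ ss) W (vM , e , _ , _ , _ , r) = build-wf _ ss (Extension.W' M W v a b vM e) r

  hoist-step : ∀ {H : Fin N → Fin N → Set} (v p q : Fin N) (M Ms : Sub N) ss → Wf M → Edge M p q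
    → SameSub Ms (extend M (v , p , q)) → ValidSteps H M ss → ¬ Vert (build M ss) v → InOneK3 (build M ss) p q
    → ValidSteps H Ms ss × SameSub (build Ms ss) (extend (build M ss) (v , p , q))
  hoist-step v p q M Ms [] W epq S _ _ _ = tt , S
  hoist-step v p q M Ms ((w , s , t) ∷ ss) W epq S (wM , est , ost , h1 , h2 , vs) vB oB =
    (wMs , from (proj₂ S s t) (inj₁ est) , ss-one (ss-sym S) (E.unique⁺ est np ost) , h1 , h2 , proj₁ rec) , proj₂ rec
    where
    vM : ¬ Vert M v
    vM x = vB (build-vert M ((w , s , t) ∷ ss) x)
    module E = Extension M W v p q vM epq
    M1 : Sub N
    M1 = extend M (w , s , t)
    W1 : Wf M1
    W1 = Extension.W' M W w s t wM est
    -- st ≠ pq: after the step, st lies in the two triangles K₃(s,t,c) (the old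
    -- one) and K₃(s,t,w), whereas pq lies in one triangle only at the end
    np : ¬ Pair s t p q
    np pr = wM (subst (Vert M) (trans (sym (at-end old)) (at-end new)) (ev2 W (proj₂ (proj₂ kc))))
      where
      kc : IsK3 M s t (proj₁ ost)
      kc = proj₁ (proj₂ ost)
      old : IsK3 M1 s t (proj₁ ost)
      old = Extension.lift-triangle M W w s t wM est kc
      new : IsK3 M1 s t w
      new = inj₁ est , inj₂ (inj₂ (inj₂ (refl , refl))) , inj₂ (inj₁ (inj₂ (refl , refl)))
      at-end : ∀ {d} → IsK3 M1 s t d → proj₁ oB ≡ d
      at-end (e1 , e2 , e3) = proj₂ (proj₂ oB)
        (k3pair (build-wf M1 ss W1 vs) pr (build-edge M1 ss e1 , build-edge M1 ss e2 , build-edge M1 ss e3))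
    wMs : ¬ Vert Ms w
    wMs x with to (proj₁ S w) x
    ... | inj₁ y = wM y
    ... | inj₂ refl = vB (build-vert M1 ss (inj₂ refl))
    rec : ValidSteps _ (extend Ms (w , s , t)) ss × SameSub (build (extend Ms (w , s , t)) ss) (extend (build M1 ss) (v , p , q))
    rec = hoist-step v p q M1 (extend Ms (w , s , t)) ss W1 (inj₁ epq)
            (ss-trans (ss-ext _ S) (ext-comm M (v , p , q) (w , s , t))) vs vB oB

module _ {N : ℕ} where
  Dist3 : Fin N → Fin N → Fin N → Set
  Dist3 a b c = a ≢ b × b ≢ c × a ≢ c

  incl-rev : ∀ {a b c x y z} → Dist3 a b c → Dist3 x y z → (∀ {u} → Vert (K3 a b c) u → Vert (K3 x y z) u)
    → ∀ {u} → Vert (K3 x y z) u → Vert (K3 a b c) u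
  incl-rev {a} {b} {c} {x} {y} {z} (ab , bc , ac) (xy , yz , xz) inc {u} iu with u ≟ a | u ≟ b
  ... | yes e | _ = inj₁ e
  ... | no _ | yes e = inj₂ (inj₁ e)
  ... | no ua | no ub with Triangle.third x y z xy yz xz (inc (inj₁ refl)) (inc (inj₂ (inj₁ refl))) ab
  ...   | d , _ , _ , _ , un = inj₂ (inj₂ (trans (sym (un iu ua ub)) (un (inc (inj₂ (inj₂ refl))) (λ e → ac (sym e)) (λ e → bc (sym e)))))

  sameK : ∀ {a b c x y z} → Dist3 a b c → Dist3 x y z → (∀ {u} → Vert (K3 a b c) u → Vert (K3 x y z) u)
    → SameSub (K3 a b c) (K3 x y z)
  sameK {a} {b} {c} {x} {y} {z} d1@(ab , bc , ac) d2@(xy , yz , xz) inc =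
    (λ u → mk⇔ inc (incl-rev d1 d2 inc)) ,
    λ u w → mk⇔ (λ e → let (iu , iw , n) = Triangle.e⇒ a b c ab bc ac e in Triangle.e⇐ x y z xy yz xz (inc iu) (inc iw) n)
                (λ e → let (iu , iw , n) = Triangle.e⇒ x y z xy yz xz e in Triangle.e⇐ a b c ab bc ac (incl-rev d1 d2 inc iu) (incl-rev d1 d2 inc iw) n)

  swapExt : ∀ (v p q r : Fin N) → SameSub (extend (K3 v p q) (r , p , q)) (extend (K3 p q r) (v , p , q))
  swapExt v p q r = (λ u → mk⇔ vert⇒ vert⇐) , (λ u w → mk⇔ edge⇒ edge⇐)
    where
    vert⇒ : ∀ {u} → Vert (extend (K3 v p q) (r , p , q)) u → Vert (extend (K3 p q r) (v , p , q)) u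
    vert⇒ (inj₁ (inj₁ e)) = inj₂ e
    vert⇒ (inj₁ (inj₂ (inj₁ e))) = inj₁ (inj₁ e)
    vert⇒ (inj₁ (inj₂ (inj₂ e))) = inj₁ (inj₂ (inj₁ e))
    vert⇒ (inj₂ e) = inj₁ (inj₂ (inj₂ e))
    vert⇐ : ∀ {u} → Vert (extend (K3 p q r) (v , p , q)) u → Vert (extend (K3 v p q) (r , p , q)) u
    vert⇐ (inj₂ e) = inj₁ (inj₁ e)
    vert⇐ (inj₁ (inj₁ e)) = inj₁ (inj₂ (inj₁ e))
    vert⇐ (inj₁ (inj₂ (inj₁ e))) = inj₁ (inj₂ (inj₂ e))
    vert⇐ (inj₁ (inj₂ (inj₂ e))) = inj₂ e
    edge⇒ : ∀ {u w} → Edge (extend (K3 v p q) (r , p , q)) u w → Edge (extend (K3 p q r) (v , p , q)) u w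
    edge⇒ (inj₁ (inj₁ e)) = inj₂ (inj₁ e)
    edge⇒ (inj₁ (inj₂ (inj₁ e))) = inj₁ (inj₁ e)
    edge⇒ (inj₁ (inj₂ (inj₂ e))) = inj₂ (inj₂ e)
    edge⇒ (inj₂ (inj₁ e)) = inj₁ (inj₂ (inj₂ (pair-swap e)))
    edge⇒ (inj₂ (inj₂ e)) = inj₁ (inj₂ (inj₁ (pair-swap e)))
    edge⇐ : ∀ {u w} → Edge (extend (K3 p q r) (v , p , q)) u w → Edge (extend (K3 v p q) (r , p , q)) u w
    edge⇐ (inj₂ (inj₁ e)) = inj₁ (inj₁ e)
    edge⇐ (inj₁ (inj₁ e)) = inj₁ (inj₂ (inj₁ e))
    edge⇐ (inj₂ (inj₂ e)) = inj₁ (inj₂ (inj₂ e))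
    edge⇐ (inj₁ (inj₂ (inj₂ e))) = inj₂ (inj₁ (pair-swap e))
    edge⇐ (inj₁ (inj₂ (inj₁ e))) = inj₂ (inj₂ (pair-swap e))

Rerootable : ∀ {N} → Sub N → Set
Rerootable {N} B = ∀ a b c → IsK3 B a b c → Σ (List (Step N)) λ ss′ →
  ValidSteps (Edge B) (K3 a b c) ss′ × SameSub (build (K3 a b c) ss′) B

rerootable-K3 : ∀ {N} {x y z : Fin N} → Dist3 x y z → Rerootable (K3 x y z)
rerootable-K3 {x = x} {y} {z} d@(xy , yz , xz) a b c (e1 , e2 , e3) =
  [] , tt , sameK (neq WK e1 , neq WK e2 , neq WK e3) d inc
  where
  open Triangle x y z xy yz xz using (WK; e⇒)
  inc : ∀ {u} → Vert (K3 a b c) u → Vert (K3 x y z) u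
  inc (inj₁ refl) = proj₁ (e⇒ e1)
  inc (inj₂ (inj₁ refl)) = proj₁ (e⇒ e2)
  inc (inj₂ (inj₂ refl)) = proj₁ (proj₂ (e⇒ e3))

module RerootStep {N} (B : Sub N) (W : Wf B) (v p q : Fin N) (vB : ¬ Vert B v) (epq : Edge B p q)
                  (o : InOneK3 B p q) (IH : Rerootable B) where
  open Extension B W v p q vB epq

  -- a triangle avoiding v is a triangle of B; reroot B there and redo the step
  reroot-old : ∀ a b c → IsK3 M' a b c → a ≢ v → b ≢ v → c ≢ v → Σ (List (Step N)) λ ss′ →
    ValidSteps (Edge M') (K3 a b c) ss′ × SameSub (build (K3 a b c) ss′) M'
  reroot-old a b c (e1 , e2 , e3) av bv cv =
    let (ss′ , V′ , S′) = IH a b c (old-edge e1 av bv , old-edge e2 bv cv , old-edge e3 av cv) in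
    ss′ ∷ʳ (v , p , q) ,
    valid-snoc⇐ (K3 a b c) ss′ (v , p , q) (valid-mono ss′ inj₁ V′)
      ((λ x → vB (to (proj₁ S′ v) x)) , from (proj₂ S′ p q) epq , ss-one (ss-sym S′) o , eVp , eVq) ,
    subst (λ X → SameSub X M') (sym (build-snoc (K3 a b c) ss′ (v , p , q))) (ss-ext (v , p , q) S′)

  -- the only triangle of B' through v is K₃(v,p,q): reroot B at the unique
  -- triangle K₃(p,q,r) on pq, and start from K₃(v,p,q) by adding r first
  reroot-vpq : Σ (List (Step N)) λ ss′ → ValidSteps (Edge M') (K3 v p q) ss′ × SameSub (build (K3 v p q) ss′) M'
  reroot-vpq =
    (r , p , q) ∷ ss″ ,
    (rK , inj₂ (inj₁ (inj₁ (refl , refl))) , Triangle.one v p q vp pq vq (inj₂ (inj₁ (inj₁ (refl , refl)))) ,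
     inj₁ (esym W pr) , inj₁ (esym W qr) , valid-mono ss″ inj₁ (proj₁ hoisted)) ,
    ss-trans (proj₂ hoisted) (ss-ext (v , p , q) S″)
    where
    r : Fin N
    r = proj₁ o
    pq : p ≢ q
    pq = neq W epq
    qr : Edge B q r
    qr = proj₁ (proj₂ (proj₁ (proj₂ o)))
    pr : Edge B p r
    pr = proj₂ (proj₂ (proj₁ (proj₂ o)))
    rK : ¬ Vert (K3 v p q) r
    rK (inj₁ refl) = vB (ev2 W pr)
    rK (inj₂ (inj₁ refl)) = neq W pr refl
    rK (inj₂ (inj₂ refl)) = neq W qr refl
    IHr : Σ (List (Step N)) λ ss′ → ValidSteps (Edge B) (K3 p q r) ss′ × SameSub (build (K3 p q r) ss′) B
    IHr = IH p q r (proj₁ (proj₂ o))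
    ss″ : List (Step N)
    ss″ = proj₁ IHr
    S″ : SameSub (build (K3 p q r) ss″) B
    S″ = proj₂ (proj₂ IHr)
    hoisted : ValidSteps (Edge B) (extend (K3 v p q) (r , p , q)) ss″
            × SameSub (build (extend (K3 v p q) (r , p , q)) ss″) (extend (build (K3 p q r) ss″) (v , p , q))
    hoisted = hoist-step v p q (K3 p q r) _ ss″ (Triangle.WK p q r pq (neq W qr) (neq W pr)) (inj₁ (inj₁ (refl , refl)))
                (swapExt v p q r) (proj₁ (proj₂ IHr)) (λ x → vB (to (proj₁ S″ v) x)) (ss-one (ss-sym S″) o)

  near-v : ∀ {a b c u} → IsK3 M' a b c → (v ≡ a ⊎ v ≡ b ⊎ v ≡ c) → Vert (K3 a b c) u → u ≡ v ⊎ Edge M' v u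
  near-v k (inj₁ refl) (inj₁ refl) = inj₁ refl
  near-v (e1 , e2 , e3) (inj₁ refl) (inj₂ (inj₁ refl)) = inj₂ e1
  near-v (e1 , e2 , e3) (inj₁ refl) (inj₂ (inj₂ refl)) = inj₂ e3
  near-v (e1 , e2 , e3) (inj₂ (inj₁ refl)) (inj₁ refl) = inj₂ (esym W' e1)
  near-v k (inj₂ (inj₁ refl)) (inj₂ (inj₁ refl)) = inj₁ refl
  near-v (e1 , e2 , e3) (inj₂ (inj₁ refl)) (inj₂ (inj₂ refl)) = inj₂ e2
  near-v (e1 , e2 , e3) (inj₂ (inj₂ refl)) (inj₁ refl) = inj₂ (esym W' e3)
  near-v (e1 , e2 , e3) (inj₂ (inj₂ refl)) (inj₂ (inj₁ refl)) = inj₂ (esym W' e2)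
  near-v k (inj₂ (inj₂ refl)) (inj₂ (inj₂ refl)) = inj₁ refl

  triangle-at-v : ∀ {a b c} → IsK3 M' a b c → (v ≡ a ⊎ v ≡ b ⊎ v ≡ c) → SameSub (K3 a b c) (K3 v p q)
  triangle-at-v k@(e1 , e2 , e3) hv =
    sameK (neq W' e1 , neq W' e2 , neq W' e3) (vp , neq W epq , vq)
      λ i → [ inj₁ , (λ e → inj₂ ([ inj₁ , inj₂ ]′ (new-nbr e))) ]′ (near-v k hv i)

  reroot-new : ∀ a b c → IsK3 M' a b c → (v ≡ a ⊎ v ≡ b ⊎ v ≡ c) → Σ (List (Step N)) λ ss′ →
    ValidSteps (Edge M') (K3 a b c) ss′ × SameSub (build (K3 a b c) ss′) M'
  reroot-new a b c k hv =
    let (ss′ , V , S′) = reroot-vpq ; S = triangle-at-v k hv in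
    ss′ , ss-valid ss′ (ss-sym S) V , ss-trans (ss-build ss′ S) S′

  rerootable' : Rerootable M'
  rerootable' a b c k with v ≟ a | v ≟ b | v ≟ c
  ... | yes e | _ | _ = reroot-new a b c k (inj₁ e)
  ... | no _ | yes e | _ = reroot-new a b c k (inj₂ (inj₁ e))
  ... | no _ | no _ | yes e = reroot-new a b c k (inj₂ (inj₂ e))
  ... | no va | no vb | no vc = reroot-old a b c k (va ∘ sym) (vb ∘ sym) (vc ∘ sym)

rerootable-build : ∀ {N} {H : Fin N → Fin N → Set} {x y z : Fin N} → Dist3 x y z
  → ∀ ss → ValidSteps H (K3 x y z) ss → Rerootable (build (K3 x y z) ss)
rerootable-build {H = H} {x} {y} {z} d@(xy , yz , xz) ss = go (reverseView ss)
  where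
  K : Sub _
  K = K3 x y z
  go : ∀ {ss} → Reverse ss → ValidSteps H K ss → Rerootable (build K ss)
  go [] _ = rerootable-K3 d
  go (ss ∶ rs ∶ʳ (v , p , q)) V =
    let (V₀ , vB , epq , o , _) = valid-snoc⇒ K ss (v , p , q) V in
    subst Rerootable (sym (build-snoc K ss (v , p , q)))
      (RerootStep.rerootable' (build K ss) (build-wf K ss (Triangle.WK x y z xy yz xz) V₀) v p q vB epq o (go rs V₀))

valid-take : ∀ {N} {H : Fin N → Fin N → Set} {M : Sub N} k ss → ValidSteps H M ss → ValidSteps H M (take k ss)
valid-take zero ss V = tt
valid-take (suc k) [] V = tt
valid-take (suc k) (s ∷ ss) (vM , e , o , h1 , h2 , V) = vM , e , o , h1 , h2 , valid-take k ss V

take-everything : ∀ {A : Set} (ss : List A) → take (3 + length ss ∸ 3) ss ≡ ss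
take-everything ss = take-all (length ss) ss ≤-refl

adj-distinct : ∀ {N} (G : SimpleGraph N) {u w} → Adj G u w → u ≢ w
adj-distinct G e refl = Adj-irrefl G e

invariant-at : ∀ {N} {H : Fin N → Fin N → Set} (x y z : Fin N) ss → Dist3 x y z → ValidSteps H (K3 x y z) ss
  → ∀ i → 3 ≤ i → i ≤ 3 + length ss → Invariant (Mᵢ x y z ss i) i
invariant-at x y z ss (xy , yz , xz) V i 3≤i i≤n = subst (Invariant (Mᵢ x y z ss i)) len I
  where
  I : Invariant (Mᵢ x y z ss i) (3 + length (take (i ∸ 3) ss))
  I = invariant-build _ (K3 x y z) 3 (take (i ∸ 3) ss) (TriangleInvariant.invariant-base x y z xy yz xz) (valid-take (i ∸ 3) ss V)
  len : 3 + length (take (i ∸ 3) ss) ≡ i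
  len = begin
    3 + length (take (i ∸ 3) ss) ≡⟨ cong (3 +_) (length-take (i ∸ 3) ss) ⟩
    3 + ((i ∸ 3) ⊓ length ss)    ≡⟨ cong (3 +_) (m≤n⇒m⊓n≡m (∸-monoˡ-≤ 3 i≤n)) ⟩
    3 + (i ∸ 3)                  ≡⟨ m+[n∸m]≡n 3≤i ⟩
    i                            ∎
    where open ≡-Reasoning

invariant-consequences : ∀ {N} {M : Sub N} {n} → Invariant M n
  → VCount M n × ECount M (2 * n ∸ 3) × SSpanningCycle M
    × (∀ a b → Edge M a b → ¬ SEdge M a b
         → Separates M a b
           × (∀ al ar → al ≢ ar → SEdge M a al → SEdge M a ar → DiffComp M a b al ar))
invariant-consequences I =
  (cs I , csU I , csL I , csV I) , ec I ,
  (cs I , csU I , subst (3 ≤_) (sym (csL I)) (n3 I) , csV I , csS I) ,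
  (λ a b e nS → separation-consequences (seps I a b e nS))

reroot-final : ∀ {N} {H : Fin N → Fin N → Set} (x y z : Fin N) ss → Dist3 x y z → ValidSteps H (K3 x y z) ss
  → let Mₙ = Mᵢ x y z ss (3 + length ss) in
    ∀ a b c → IsK3 Mₙ a b c
    → Σ (List (Step N)) λ ss′ → TriSeq (Edge Mₙ) a b c ss′ × SameSub (Mᵢ a b c ss′ (3 + length ss′)) Mₙ
reroot-final x y z ss d V a b c k@(eab , ebc , eac) =
  let (ss′ , V′ , S′) = subst (Rerootable ∘ build (K3 x y z)) (sym (take-everything ss)) (rerootable-build d ss V) a b c k
  in ss′ , (eab , ebc , eac , V′) , subst (λ L → SameSub (build (K3 a b c) L) _) (sym (take-everything ss′)) S′

lemma3p6 : ∀ {N} (G : SimpleGraph N) (x y z : Fin N) (ss : List (Step N))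
    → TriSeq (Adj G) x y z ss
    → (∀ i → 3 ≤ i → i ≤ 3 + length ss
         → VCount (Mᵢ x y z ss i) i
           × ECount (Mᵢ x y z ss i) (2 * i ∸ 3)
           × SSpanningCycle (Mᵢ x y z ss i)
           × (∀ a b → Edge (Mᵢ x y z ss i) a b → ¬ SEdge (Mᵢ x y z ss i) a b
                → Separates (Mᵢ x y z ss i) a b
                  × (∀ al ar → al ≢ ar → SEdge (Mᵢ x y z ss i) a al → SEdge (Mᵢ x y z ss i) a ar
                       → DiffComp (Mᵢ x y z ss i) a b al ar)))
      × (∀ a b c → IsK3 (Mᵢ x y z ss (3 + length ss)) a b c
           → Σ (List (Step N)) λ ss′
               → TriSeq (Edge (Mᵢ x y z ss (3 + length ss))) a b c ss′
                 × SameSub (Mᵢ a b c ss′ (3 + length ss′)) (Mᵢ x y z ss (3 + length ss)))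
lemma3p6 G x y z ss (hxy , hyz , hxz , V) =
  (λ i 3≤i i≤n → invariant-consequences (invariant-at x y z ss distinct V i 3≤i i≤n)) ,
  reroot-final x y z ss distinct V
  where
  distinct : Dist3 x y z
  distinct = adj-distinct G hxy , adj-distinct G hyz , adj-distinct G hxz
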